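{- Let $p>2$ be a prime. Then $$\sum_{k=2}^{p-1}\frac{1}{k^2}\sum_{m=k}^{p-1}\frac{(-1)^{m-k}}{\binom{m}{k}}\equiv -2q_p(2)\pmod p.$$
   Context: $q_p(2)=(2^{p-1}-1)/p$ is the Fermat quotient. Congruences between rational numbers whose denominators are prime to $p$ are understood in the ring of $p$-integral rationals. -}

module Defs where

open import Data.Nat as ℕ using (ℕ; zero; suc; _∸_; _^_)
open import Data.Nat.Combinatorics using (_C_)
open import Data.Nat.Divisibility using (_∣_)
open import Data.Integer as ℤ using (ℤ; +_)
open import Data.Rational as ℚ using (ℚ; ↥_; ↧ₙ_; _/_)
open import Relation.Nullary using (¬_)
open import Data.Product using (_×_)

-- reciprocal of a natural number as a rational; 1/0 := 0 is a junk value
-- never used below (all arguments are ≥ 1)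
inv : ℕ → ℚ
inv zero    = ℚ.0ℚ
inv (suc n) = + 1 / suc n

sgn : ℕ → ℚ
sgn zero          = ℚ.1ℚ
sgn (suc zero)    = ℚ.-  ℚ.1ℚ
sgn (suc (suc n)) = sgn n

-- Σ_{i=a}^{b} f i  (empty, i.e. 0, when b < a)
sumFromTo : ℕ → ℕ → (ℕ → ℚ) → ℚ
sumFromTo a b f = go (suc b ∸ a)
  where
  go : ℕ → ℚ
  go zero    = ℚ.0ℚ
  go (suc n) = go n ℚ.+ f (a ℕ.+ n)

fermatQuotient2 : (p : ℕ) → .{{_ : ℕ.NonZero p}} → ℚ
fermatQuotient2 p = (+ (2 ^ (p ∸ 1)) ℤ.- + 1) / p

-- x ≡ y (mod p) in the ring of p-integral rationals Z_(p):
-- x - y = p * z with z p-integral, i.e. (x - y) in reduced form has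
-- numerator divisible by p and denominator prime to p.
_≡_[modℚ_] : ℚ → ℚ → ℕ → Set
x ≡ y [modℚ p ] = (p ∣ ℤ.∣ ↥ (x ℚ.- y) ∣) × ¬ (p ∣ ↧ₙ (x ℚ.- y))

S : ℕ → ℚ
S p = sumFromTo 2 (p ∸ 1) λ k →
        inv (k ^ 2) ℚ.* sumFromTo k (p ∸ 1) (λ m → sgn (m ∸ k) ℚ.* inv (m C k))

-- Interchanging the two sums and evaluating the inner ones with
-- 1/C(m,k) = (m+1)/(m+2) (1/C(m+1,k) + 1/C(m+1,k+1)) gives, for n = p - 1 even, the exact identity
--   S(p) = 3/2 (H⁽²⁾ₙ + A⁽²⁾ₙ) + A⁽¹⁾ₙ,   where H⁽²⁾ₙ = Σ_{k≤n} 1/k² and A⁽ʳ⁾ₙ = Σ_{k≤n} (-1)^k/kʳ.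
-- Modulo p, C(n,k) ≡ (-1)^k and hence 1/C(n,k) ≡ (-1)^k. The first congruence turns the identities
-- Σ (-1)^(k-1) C(n,k)/k = Hₙ and Σ (-1)^(k-1) C(n,k)/k² = Σ_j H_j/j into 2Hₙ ≡ 0 and, together with
-- 2 Σ_j H_j/j = Hₙ² + H⁽²⁾ₙ, into 3H⁽²⁾ₙ ≡ 0; the second shows that Σ (-1)^k/(k² C(n,k)) = H⁽²⁾ₙ + 2A⁽²⁾ₙ
-- is ≡ H⁽²⁾ₙ, so 2A⁽²⁾ₙ ≡ 0. Finally 2 q_p(2) = Σ_{0<k<p} C(p,k)/p = Σ_{j<n} C(n,j)/(j+1) ≡ -A⁽¹⁾ₙ.

module Submission where

open import Data.Integer as ℤ using (ℤ)
import Data.Integer.Properties as ℤP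
open import Data.Integer.Divisibility.Signed as ℤ∣ using (∣ᵤ⇒∣; ∣⇒∣ᵤ) renaming (_∣_ to _∣ℤ_)
import Data.Integer.Tactic.RingSolver as ℤ-Ring
open import Data.Nat as ℕ using (ℕ; zero; suc; _∸_; _^_; _≤_; _<_; _>_; z≤n; s≤s)
open import Data.Nat.Combinatorics using (_C_; k>n⇒nCk≡0; nCk+nC[k+1]≡[n+1]C[k+1])
open import Data.Nat.Divisibility using (_∣_; divides; ∣-refl; ∣⇒≤; m∣m*n)
open import Data.Nat.Primality using (Prime; prime⇒nonZero; prime⇒nonTrivial; euclidsLemma; composite)
import Data.Nat.Properties as ℕP
import Data.Nat.Tactic.RingSolver as ℕ-Ring
open import Data.Product using (_×_; _,_; proj₂)
open import Data.Rational as ℚ using (ℚ; 0ℚ; 1ℚ; _+_; _*_; _-_; -_; _/_; ↥_; ↧_; toℚᵘ)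
import Data.Rational.Properties as ℚP
open import Data.Rational.Solver using (module +-*-Solver)
open import Data.Rational.Unnormalised as ℚᵘ using (mkℚᵘ; *≡*) renaming (_≃_ to _≃ᵘ_)
import Data.Rational.Unnormalised.Properties as ℚᵘP
open import Function using (_∘_)
open import Data.Sum using (_⊎_; inj₁; inj₂)
open import Relation.Binary.PropositionalEquality
open import Relation.Nullary using (¬_; contradiction)
open import Algebra.Properties.Group ℚP.+-0-group using (⁻¹-involutive)

open import Defs

open +-*-Solver using (solve; _:+_; _:*_; _:=_; :-_; con)
open ≡-Reasoning

∑ : ℕ → (ℕ → ℚ) → ℚ
∑ zero    f = 0ℚ
∑ (suc n) f = ∑ n f + f n

∑-cong : ∀ n {f g : ℕ → ℚ} → (∀ i → i < n → f i ≡ g i) → ∑ n f ≡ ∑ n g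
∑-cong zero    eq = refl
∑-cong (suc n) eq = cong₂ _+_ (∑-cong n λ i i<n → eq i (ℕP.m<n⇒m<1+n i<n)) (eq n ℕP.≤-refl)

∑-zero : ∀ n {f : ℕ → ℚ} → (∀ i → i < n → f i ≡ 0ℚ) → ∑ n f ≡ 0ℚ
∑-zero zero    eq = refl
∑-zero (suc n) eq = cong₂ _+_ (∑-zero n λ i i<n → eq i (ℕP.m<n⇒m<1+n i<n)) (eq n ℕP.≤-refl)

∑-distrib-+ : ∀ n (f g : ℕ → ℚ) → ∑ n (λ i → f i + g i) ≡ ∑ n f + ∑ n g
∑-distrib-+ zero    f g = refl
∑-distrib-+ (suc n) f g = trans (cong (_+ (f n + g n)) (∑-distrib-+ n f g))
  (solve 4 (λ a b c d → (a :+ b) :+ (c :+ d) := (a :+ c) :+ (b :+ d)) refl (∑ n f) (∑ n g) (f n) (g n))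

neg-distrib-∑ : ∀ n (f : ℕ → ℚ) → ∑ n (λ i → - f i) ≡ - ∑ n f
neg-distrib-∑ zero    f = refl
neg-distrib-∑ (suc n) f = trans (cong (_+ - f n) (neg-distrib-∑ n f)) (sym (ℚP.neg-distrib-+ (∑ n f) (f n)))

∑-distrib-- : ∀ n (f g : ℕ → ℚ) → ∑ n (λ i → f i - g i) ≡ ∑ n f - ∑ n g
∑-distrib-- n f g = trans (∑-distrib-+ n f (λ i → - g i)) (cong (∑ n f +_) (neg-distrib-∑ n g))

*-distribˡ-∑ : ∀ n c (f : ℕ → ℚ) → ∑ n (λ i → c * f i) ≡ c * ∑ n f
*-distribˡ-∑ zero    c f = sym (ℚP.*-zeroʳ c)
*-distribˡ-∑ (suc n) c f =
  trans (cong (_+ c * f n) (*-distribˡ-∑ n c f)) (sym (ℚP.*-distribˡ-+ c (∑ n f) (f n)))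

∑-suc : ∀ n (f : ℕ → ℚ) → ∑ (suc n) f ≡ f 0 + ∑ n (λ i → f (suc i))
∑-suc zero    f = trans (ℚP.+-identityˡ (f 0)) (sym (ℚP.+-identityʳ (f 0)))
∑-suc (suc n) f = trans (cong (_+ f (suc n)) (∑-suc n f)) (ℚP.+-assoc (f 0) _ (f (suc n)))

∑-+ : ∀ m n (f : ℕ → ℚ) → ∑ (m ℕ.+ n) f ≡ ∑ m f + ∑ n (λ i → f (m ℕ.+ i))
∑-+ m zero    f rewrite ℕP.+-identityʳ m = sym (ℚP.+-identityʳ (∑ m f))
∑-+ m (suc n) f rewrite ℕP.+-suc m n =
  trans (cong (_+ f (m ℕ.+ n)) (∑-+ m n f)) (ℚP.+-assoc (∑ m f) _ (f (m ℕ.+ n)))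

∑-vanishing-tail : ∀ {m} n (f : ℕ → ℚ) → (∀ i → m ≤ i → f i ≡ 0ℚ) → m ≤ n → ∑ n f ≡ ∑ m f
∑-vanishing-tail zero    f vanish z≤n = refl
∑-vanishing-tail (suc n) f vanish m≤1+n with ℕP.m≤n⇒m<n∨m≡n m≤1+n
... | inj₁ (s≤s m≤n) = trans (cong₂ _+_ (∑-vanishing-tail n f vanish m≤n) (vanish n m≤n)) (ℚP.+-identityʳ _)
... | inj₂ refl      = refl

∑-comm : ∀ m n (F : ℕ → ℕ → ℚ) → ∑ m (λ i → ∑ n (F i)) ≡ ∑ n (λ j → ∑ m (λ i → F i j))
∑-comm zero    n F = sym (∑-zero n λ _ _ → refl)
∑-comm (suc m) n F = trans (cong (_+ ∑ n (F m)) (∑-comm m n F)) (sym (∑-distrib-+ n _ (F m)))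

[1+a+n]∸a≡1+n : ∀ a n → suc (a ℕ.+ n) ∸ a ≡ suc n
[1+a+n]∸a≡1+n a n = trans (cong (_∸ a) (sym (ℕP.+-suc a n))) (ℕP.m+n∸m≡n a (suc n))

-- sumFromTo recurses through a local function; rewriting its length suc (a + n) ∸ a
-- to suc n exposes that recursion.
sumFromTo-∑ : ∀ a n (f : ℕ → ℚ) → sumFromTo a (a ℕ.+ n) f ≡ ∑ (suc n) (λ i → f (a ℕ.+ i))
sumFromTo-∑ a zero    f rewrite [1+a+n]∸a≡1+n a zero = refl
sumFromTo-∑ a (suc n) f with sumFromTo-∑ a n f
... | ih rewrite [1+a+n]∸a≡1+n a (suc n) | [1+a+n]∸a≡1+n a n = cong (_+ f (a ℕ.+ suc n)) ih

sgn-suc : ∀ k → sgn (suc k) ≡ - sgn k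
sgn-suc zero    = refl
sgn-suc (suc k) = trans (sym (⁻¹-involutive (sgn k))) (cong -_ (sym (sgn-suc k)))

sgn-+ : ∀ a b → sgn (a ℕ.+ b) ≡ sgn a * sgn b
sgn-+ zero    b = sym (ℚP.*-identityˡ (sgn b))
sgn-+ (suc a) b = begin
  sgn (suc (a ℕ.+ b))     ≡⟨ sgn-suc (a ℕ.+ b) ⟩
  - sgn (a ℕ.+ b)         ≡⟨ cong -_ (sgn-+ a b) ⟩
  - (sgn a * sgn b)       ≡⟨ ℚP.neg-distribˡ-* (sgn a) (sgn b) ⟩
  - sgn a * sgn b         ≡⟨ cong (_* sgn b) (sgn-suc a) ⟨
  sgn (suc a) * sgn b     ∎

sgn*sgn≡1 : ∀ k → sgn k * sgn k ≡ 1ℚ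
sgn*sgn≡1 k = trans (sym (sgn-+ k k)) (sgn-even k)
  where
  sgn-even : ∀ k → sgn (k ℕ.+ k) ≡ 1ℚ
  sgn-even zero    = refl
  sgn-even (suc k) rewrite ℕP.+-suc k k = sgn-even k

sgn-∸ : ∀ {m k} → k ≤ m → sgn (m ∸ k) ≡ sgn m * sgn k
sgn-∸ {m} {k} k≤m = begin
  sgn (m ∸ k)                   ≡⟨ ℚP.*-identityʳ (sgn (m ∸ k)) ⟨
  sgn (m ∸ k) * 1ℚ              ≡⟨ cong (sgn (m ∸ k) *_) (sgn*sgn≡1 k) ⟨
  sgn (m ∸ k) * (sgn k * sgn k) ≡⟨ ℚP.*-assoc (sgn (m ∸ k)) (sgn k) (sgn k) ⟨
  sgn (m ∸ k) * sgn k * sgn k   ≡⟨ cong (_* sgn k) (sgn-+ (m ∸ k) k) ⟨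
  sgn (m ∸ k ℕ.+ k) * sgn k     ≡⟨ cong (λ i → sgn i * sgn k) (ℕP.m∸n+n≡m k≤m) ⟩
  sgn m * sgn k                 ∎

sgn≡1⊎2∣suc : ∀ n → sgn n ≡ 1ℚ ⊎ 2 ∣ suc n
sgn≡1⊎2∣suc zero          = inj₁ refl
sgn≡1⊎2∣suc (suc zero)    = inj₂ ∣-refl
sgn≡1⊎2∣suc (suc (suc n)) with sgn≡1⊎2∣suc n
... | inj₁ sgn≡1           = inj₁ sgn≡1
... | inj₂ (divides q eq) = inj₂ (divides (suc q) (cong (suc ∘ suc) eq))

∑-alt-telescope : ∀ n (u : ℕ → ℚ) → ∑ n (λ j → sgn j * (u j + u (suc j))) ≡ u 0 - sgn n * u n
∑-alt-telescope zero    u = solve 1 (λ a → con 0ℚ := a :+ :- (con 1ℚ :* a)) refl (u 0)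
∑-alt-telescope (suc n) u = begin
  ∑ n (λ j → sgn j * (u j + u (suc j))) + sgn n * (u n + u (suc n))
    ≡⟨ cong (_+ sgn n * (u n + u (suc n))) (∑-alt-telescope n u) ⟩
  u 0 - sgn n * u n + sgn n * (u n + u (suc n))
    ≡⟨ solve 4 (λ a s b c → a :+ :- (s :* b) :+ s :* (b :+ c) := a :+ :- ((:- s) :* c)) refl (u 0) (sgn n) (u n) (u (suc n)) ⟩
  u 0 - (- sgn n) * u (suc n)
    ≡⟨ cong (λ s → u 0 - s * u (suc n)) (sgn-suc n) ⟨
  u 0 - sgn (suc n) * u (suc n) ∎

ι : ℕ → ℚ
ι n = ℤ.+ n / 1

toℚᵘ-/ : ∀ i d → toℚᵘ (i / suc d) ≃ᵘ mkℚᵘ i d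
toℚᵘ-/ i d = ℚP.toℚᵘ-fromℚᵘ (mkℚᵘ i d)

/1-homo-+ : ∀ i j → (i ℤ.+ j) / 1 ≡ i / 1 + j / 1
/1-homo-+ i j = ℚP.toℚᵘ-injective (ℚᵘP.≃-trans (toℚᵘ-/ (i ℤ.+ j) 0) (ℚᵘP.≃-sym (ℚᵘP.≃-trans
  (ℚP.toℚᵘ-homo-+ (i / 1) (j / 1))
  (ℚᵘP.≃-trans (ℚᵘP.+-cong (toℚᵘ-/ i 0) (toℚᵘ-/ j 0))
    (*≡* (eq i j))))))
  where
  eq : ∀ i j → (i ℤ.* ℤ.+ 1 ℤ.+ j ℤ.* ℤ.+ 1) ℤ.* ℤ.+ 1 ≡ (i ℤ.+ j) ℤ.* ℤ.+ 1
  eq = ℤ-Ring.solve-∀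

/1-homo-* : ∀ i j → (i ℤ.* j) / 1 ≡ (i / 1) * (j / 1)
/1-homo-* i j = ℚP.toℚᵘ-injective (ℚᵘP.≃-trans (toℚᵘ-/ (i ℤ.* j) 0) (ℚᵘP.≃-sym (ℚᵘP.≃-trans
  (ℚP.toℚᵘ-homo-* (i / 1) (j / 1))
  (ℚᵘP.≃-trans (ℚᵘP.*-cong (toℚᵘ-/ i 0) (toℚᵘ-/ j 0))
    (*≡* refl)))))

/-as-* : ∀ i d → i / suc d ≡ (i / 1) * inv (suc d)
/-as-* i d = ℚP.toℚᵘ-injective (ℚᵘP.≃-trans (toℚᵘ-/ i d) (ℚᵘP.≃-sym (ℚᵘP.≃-trans
  (ℚP.toℚᵘ-homo-* (i / 1) (inv (suc d)))
  (ℚᵘP.≃-trans (ℚᵘP.*-cong (toℚᵘ-/ i 0) (toℚᵘ-/ (ℤ.+ 1) d))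
    (*≡* (eq i (ℤ.+ suc d)))))))
  where
  eq : ∀ i e → i ℤ.* ℤ.+ 1 ℤ.* e ≡ i ℤ.* (ℤ.+ 1 ℤ.* e)
  eq = ℤ-Ring.solve-∀

ι-+ : ∀ a b → ι (a ℕ.+ b) ≡ ι a + ι b
ι-+ a b = trans (cong (_/ 1) (ℤP.pos-+ a b)) (/1-homo-+ (ℤ.+ a) (ℤ.+ b))

ι-* : ∀ a b → ι (a ℕ.* b) ≡ ι a * ι b
ι-* a b = trans (cong (_/ 1) (ℤP.pos-* a b)) (/1-homo-* (ℤ.+ a) (ℤ.+ b))

ι*inv≡1 : ∀ n → n ≢ 0 → ι n * inv n ≡ 1ℚ
ι*inv≡1 zero    n≢0 = contradiction refl n≢0
ι*inv≡1 (suc n) _   = trans (sym (/-as-* (ℤ.+ suc n) n))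
  (ℚP.toℚᵘ-injective (ℚᵘP.≃-trans (toℚᵘ-/ (ℤ.+ suc n) n) (*≡* (ℤP.*-comm (ℤ.+ suc n) (ℤ.+ 1)))))

inverse-unique : ∀ x y z → x * y ≡ 1ℚ → x * z ≡ 1ℚ → y ≡ z
inverse-unique x y z xy≡1 xz≡1 = begin
  y           ≡⟨ ℚP.*-identityˡ y ⟨
  1ℚ * y      ≡⟨ cong (_* y) xz≡1 ⟨
  x * z * y   ≡⟨ solve 3 (λ x y z → x :* z :* y := x :* y :* z) refl x y z ⟩
  x * y * z   ≡⟨ cong (_* z) xy≡1 ⟩
  1ℚ * z      ≡⟨ ℚP.*-identityˡ z ⟩
  z           ∎

inv-* : ∀ a b → inv (a ℕ.* b) ≡ inv a * inv b
inv-* zero        b           = sym (ℚP.*-zeroˡ (inv b))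
inv-* (suc a)     zero        = trans (cong inv (ℕP.*-zeroʳ a)) (sym (ℚP.*-zeroʳ (inv (suc a))))
inv-* a@(suc _) b@(suc _) = inverse-unique (ι (a ℕ.* b)) _ _ (ι*inv≡1 (a ℕ.* b) λ ()) (begin
  ι (a ℕ.* b) * (inv a * inv b)  ≡⟨ cong (_* (inv a * inv b)) (ι-* a b) ⟩
  ι a * ι b * (inv a * inv b)    ≡⟨ solve 4 (λ x y u v → x :* y :* (u :* v) := (x :* u) :* (y :* v)) refl (ι a) (ι b) (inv a) (inv b) ⟩
  ι a * inv a * (ι b * inv b)    ≡⟨ cong₂ _*_ (ι*inv≡1 a λ ()) (ι*inv≡1 b λ ()) ⟩
  1ℚ                             ∎)

ι*ι-cong : ∀ a b c d → a ℕ.* b ≡ c ℕ.* d → ι a * ι b ≡ ι c * ι d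
ι*ι-cong a b c d eq = trans (sym (ι-* a b)) (trans (cong ι eq) (ι-* c d))

inv-cross : ∀ a b X Y → a ℕ.* X ≡ b ℕ.* Y → X ≢ 0 → b ≢ 0 → Y ≢ 0 → inv X ≡ ι a * inv b * inv Y
inv-cross a b X Y aX≡bY X≢0 b≢0 Y≢0 = inverse-unique (ι X) _ _ (ι*inv≡1 X X≢0) (begin
  ι X * (ι a * inv b * inv Y)   ≡⟨ solve 4 (λ x a u v → x :* (a :* u :* v) := a :* x :* (u :* v)) refl (ι X) (ι a) (inv b) (inv Y) ⟩
  ι a * ι X * (inv b * inv Y)   ≡⟨ cong (_* (inv b * inv Y)) (ι*ι-cong a X b Y aX≡bY) ⟩
  ι b * ι Y * (inv b * inv Y)   ≡⟨ solve 4 (λ b y u v → b :* y :* (u :* v) := (b :* u) :* (y :* v)) refl (ι b) (ι Y) (inv b) (inv Y) ⟩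
  ι b * inv b * (ι Y * inv Y)   ≡⟨ cong₂ _*_ (ι*inv≡1 b b≢0) (ι*inv≡1 Y Y≢0) ⟩
  1ℚ                            ∎)

ι*inv-cross : ∀ a b X Y → a ℕ.* X ≡ b ℕ.* Y → a ≢ 0 → b ≢ 0 → ι Y * inv a ≡ ι X * inv b
ι*inv-cross a b X Y aX≡bY a≢0 b≢0 = begin
  ι Y * inv a                          ≡⟨ ℚP.*-identityˡ _ ⟨
  1ℚ * (ι Y * inv a)                   ≡⟨ cong (_* (ι Y * inv a)) (ι*inv≡1 b b≢0) ⟨
  ι b * inv b * (ι Y * inv a)          ≡⟨ solve 4 (λ b u y v → b :* u :* (y :* v) := b :* y :* (u :* v)) refl (ι b) (inv b) (ι Y) (inv a) ⟩
  ι b * ι Y * (inv b * inv a)          ≡⟨ cong (_* (inv b * inv a)) (ι*ι-cong a X b Y aX≡bY) ⟨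
  ι a * ι X * (inv b * inv a)          ≡⟨ solve 4 (λ a x u v → a :* x :* (u :* v) := a :* v :* (x :* u)) refl (ι a) (ι X) (inv b) (inv a) ⟩
  ι a * inv a * (ι X * inv b)          ≡⟨ cong (_* (ι X * inv b)) (ι*inv≡1 a a≢0) ⟩
  1ℚ * (ι X * inv b)                   ≡⟨ ℚP.*-identityˡ _ ⟩
  ι X * inv b                          ∎

binomial : ℕ → ℕ → ℕ
binomial n       zero    = 1
binomial zero    (suc k) = 0
binomial (suc n) (suc k) = binomial n k ℕ.+ binomial n (suc k)

C≡binomial : ∀ n k → n C k ≡ binomial n k
C≡binomial n       zero    = refl
C≡binomial zero    (suc k) = k>n⇒nCk≡0 {0} {suc k} (s≤s z≤n)
C≡binomial (suc n) (suc k) = trans (sym (nCk+nC[k+1]≡[n+1]C[k+1] n k)) (cong₂ ℕ._+_ (C≡binomial n k) (C≡binomial n (suc k)))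

n<k⇒binomial≡0 : ∀ {n k} → n < k → binomial n k ≡ 0
n<k⇒binomial≡0 {zero}  {suc k} _         = refl
n<k⇒binomial≡0 {suc n} {suc k} (s≤s n<k) = cong₂ ℕ._+_ (n<k⇒binomial≡0 n<k) (n<k⇒binomial≡0 (ℕP.m<n⇒m<1+n n<k))

k≤n⇒binomial≢0 : ∀ {n k} → k ≤ n → binomial n k ≢ 0
k≤n⇒binomial≢0 {k = zero}              _         ()
k≤n⇒binomial≢0 {suc n} {suc k} (s≤s k≤n) eq = k≤n⇒binomial≢0 k≤n (ℕP.m+n≡0⇒m≡0 (binomial n k) eq)

binomial[n,1]≡n : ∀ n → binomial n 1 ≡ n
binomial[n,1]≡n zero    = refl
binomial[n,1]≡n (suc n) = cong suc (binomial[n,1]≡n n)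

binomial[n,n]≡1 : ∀ n → binomial n n ≡ 1
binomial[n,n]≡1 zero    = refl
binomial[n,n]≡1 (suc n) = begin
  binomial n n ℕ.+ binomial n (suc n)  ≡⟨ cong (binomial n n ℕ.+_) (n<k⇒binomial≡0 (ℕP.n<1+n n)) ⟩
  binomial n n ℕ.+ 0                   ≡⟨ ℕP.+-identityʳ (binomial n n) ⟩
  binomial n n                         ≡⟨ binomial[n,n]≡1 n ⟩
  1                                    ∎

[k+1]*binomial[n+1,k+1]≡[n+1]*binomial[n,k] : ∀ n k → suc k ℕ.* binomial (suc n) (suc k) ≡ suc n ℕ.* binomial n k
[k+1]*binomial[n+1,k+1]≡[n+1]*binomial[n,k] zero    zero    = refl
[k+1]*binomial[n+1,k+1]≡[n+1]*binomial[n,k] zero    (suc k) = ℕP.*-zeroʳ (suc (suc k))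
[k+1]*binomial[n+1,k+1]≡[n+1]*binomial[n,k] (suc n) zero    = begin
  1 ℕ.* binomial (suc (suc n)) 1  ≡⟨ ℕP.*-identityˡ _ ⟩
  binomial (suc (suc n)) 1        ≡⟨ binomial[n,1]≡n (suc (suc n)) ⟩
  suc (suc n)                     ≡⟨ ℕP.*-identityʳ (suc (suc n)) ⟨
  suc (suc n) ℕ.* 1               ∎
[k+1]*binomial[n+1,k+1]≡[n+1]*binomial[n,k] (suc n) (suc k) = begin
  suc (suc k) ℕ.* (x ℕ.+ y)                                    ≡⟨ regroup (suc k) x y ⟩
  x ℕ.+ (suc k ℕ.* x ℕ.+ suc (suc k) ℕ.* y)                    ≡⟨ cong (x ℕ.+_) (cong₂ ℕ._+_
                                                                    ([k+1]*binomial[n+1,k+1]≡[n+1]*binomial[n,k] n k)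
                                                                    ([k+1]*binomial[n+1,k+1]≡[n+1]*binomial[n,k] n (suc k))) ⟩
  x ℕ.+ (suc n ℕ.* binomial n k ℕ.+ suc n ℕ.* binomial n (suc k)) ≡⟨ collect n (binomial n k) (binomial n (suc k)) ⟩
  suc (suc n) ℕ.* x                                            ∎
  where
  x y : ℕ
  x = binomial (suc n) (suc k)
  y = binomial (suc n) (suc (suc k))
  regroup : ∀ k x y → suc k ℕ.* (x ℕ.+ y) ≡ x ℕ.+ (k ℕ.* x ℕ.+ suc k ℕ.* y)
  regroup = ℕ-Ring.solve-∀
  collect : ∀ n u v → u ℕ.+ v ℕ.+ (suc n ℕ.* u ℕ.+ suc n ℕ.* v) ≡ suc (suc n) ℕ.* (u ℕ.+ v)
  collect = ℕ-Ring.solve-∀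

[1+k+t]*binomial[k+t,k]≡[1+t]*binomial[1+k+t,k] : ∀ k t → suc (k ℕ.+ t) ℕ.* binomial (k ℕ.+ t) k ≡ suc t ℕ.* binomial (suc (k ℕ.+ t)) k
[1+k+t]*binomial[k+t,k]≡[1+t]*binomial[1+k+t,k] zero    t = refl
[1+k+t]*binomial[k+t,k]≡[1+t]*binomial[1+k+t,k] (suc k) t = ℕP.+-cancelˡ-≡ (suc k ℕ.* (u ℕ.+ v)) _ _ (begin
  suc k ℕ.* (u ℕ.+ v) ℕ.+ suc m ℕ.* v  ≡⟨ cong (ℕ._+ suc m ℕ.* v) ([k+1]*binomial[n+1,k+1]≡[n+1]*binomial[n,k] m k) ⟩
  suc m ℕ.* u ℕ.+ suc m ℕ.* v          ≡⟨ split k t u v ⟩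
  suc k ℕ.* (u ℕ.+ v) ℕ.+ suc t ℕ.* (u ℕ.+ v) ∎)
  where
  m u v : ℕ
  m = suc (k ℕ.+ t)
  u = binomial m k
  v = binomial m (suc k)
  split : ∀ k t u v → suc (suc (k ℕ.+ t)) ℕ.* u ℕ.+ suc (suc (k ℕ.+ t)) ℕ.* v ≡ suc k ℕ.* (u ℕ.+ v) ℕ.+ suc t ℕ.* (u ℕ.+ v)
  split = ℕ-Ring.solve-∀

binomialℚ : ℕ → ℕ → ℚ
binomialℚ n k = ι (binomial n k)

-- invBinomial m k = inv 0 = 0 for k > m, so sums involving it may run past k = m.
invBinomial : ℕ → ℕ → ℚ
invBinomial m k = inv (binomial m k)

binomialℚ-absorption : ∀ n j → binomialℚ n j * inv (suc j) ≡ binomialℚ (suc n) (suc j) * inv (suc n)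
binomialℚ-absorption n j = ι*inv-cross (suc j) (suc n) _ _ ([k+1]*binomial[n+1,k+1]≡[n+1]*binomial[n,k] n j) (λ ()) (λ ())

inv*invBinomial-suc : ∀ m k → inv (suc k) * invBinomial (suc m) (suc k) ≡ inv (suc m) * invBinomial m k
inv*invBinomial-suc m k = begin
  inv (suc k) * invBinomial (suc m) (suc k)  ≡⟨ inv-* (suc k) (binomial (suc m) (suc k)) ⟨
  inv (suc k ℕ.* binomial (suc m) (suc k))   ≡⟨ cong inv ([k+1]*binomial[n+1,k+1]≡[n+1]*binomial[n,k] m k) ⟩
  inv (suc m ℕ.* binomial m k)               ≡⟨ inv-* (suc m) (binomial m k) ⟩
  inv (suc m) * invBinomial m k              ∎

invBinomial-suc-suc : ∀ {n j} → j ≤ n → invBinomial (suc n) (suc j) ≡ ι (suc j) * inv (suc n) * invBinomial n j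
invBinomial-suc-suc {n} {j} j≤n = inv-cross (suc j) (suc n) _ _ ([k+1]*binomial[n+1,k+1]≡[n+1]*binomial[n,k] n j)
  (k≤n⇒binomial≢0 (s≤s j≤n)) (λ ()) (k≤n⇒binomial≢0 j≤n)

invBinomial-suc : ∀ {m k} → k ≤ m → invBinomial (suc m) k ≡ invBinomial m k - ι k * inv (suc m) * invBinomial m k
invBinomial-suc {m} {k} k≤m with ℕP.m≤n⇒∃[o]m+o≡n k≤m
... | t , refl = begin
  invBinomial (suc m) k
    ≡⟨ inv-cross (suc t) (suc m) _ _ (sym ([1+k+t]*binomial[k+t,k]≡[1+t]*binomial[1+k+t,k] k t))
                 (k≤n⇒binomial≢0 (ℕP.m≤n⇒m≤1+n k≤m)) (λ ()) (k≤n⇒binomial≢0 k≤m) ⟩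
  ι (suc t) * inv (suc m) * B
    ≡⟨ cong (λ x → x * inv (suc m) * B) ι[1+t]≡ι[1+m]-ι[k] ⟩
  (ι (suc m) - ι k) * inv (suc m) * B
    ≡⟨ solve 4 (λ a b u c → (a :+ :- b) :* u :* c := a :* u :* c :+ :- (b :* u :* c)) refl (ι (suc m)) (ι k) (inv (suc m)) B ⟩
  ι (suc m) * inv (suc m) * B - ι k * inv (suc m) * B
    ≡⟨ cong (λ x → x * B - ι k * inv (suc m) * B) (ι*inv≡1 (suc m) (λ ())) ⟩
  1ℚ * B - ι k * inv (suc m) * B
    ≡⟨ cong (_- ι k * inv (suc m) * B) (ℚP.*-identityˡ B) ⟩
  B - ι k * inv (suc m) * B ∎
  where
  B : ℚ
  B = invBinomial m k
  ι[1+t]≡ι[1+m]-ι[k] : ι (suc t) ≡ ι (suc m) - ι k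
  ι[1+t]≡ι[1+m]-ι[k] = begin
    ι (suc t)                   ≡⟨ solve 2 (λ a b → a := b :+ a :+ :- b) refl (ι (suc t)) (ι k) ⟩
    ι k + ι (suc t) - ι k       ≡⟨ cong (_- ι k) (ι-+ k (suc t)) ⟨
    ι (k ℕ.+ suc t) - ι k       ≡⟨ cong (λ x → ι x - ι k) (ℕP.+-suc k t) ⟩
    ι (suc m) - ι k             ∎

-- Binomial sums and harmonic numbers

∑-binomial-pascal : ∀ N (w : ℕ → ℚ) → ∑ (suc (suc N)) (λ k → w k * binomialℚ (suc N) k)
                  ≡ ∑ (suc N) (λ k → w k * binomialℚ N k) + ∑ (suc N) (λ k → w (suc k) * binomialℚ N k)
∑-binomial-pascal N w = begin
  ∑ (suc (suc N)) (λ k → w k * binomialℚ (suc N) k)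
    ≡⟨ ∑-suc (suc N) _ ⟩
  w 0 * ι 1 + ∑ (suc N) (λ j → w (suc j) * ι (binomial N j ℕ.+ binomial N (suc j)))
    ≡⟨ cong (w 0 * ι 1 +_) (trans (∑-cong (suc N) λ j _ → pascal j) (∑-distrib-+ (suc N) _ _)) ⟩
  w 0 * ι 1 + (∑ (suc N) (λ j → w (suc j) * binomialℚ N j) + ∑ (suc N) (λ j → w (suc j) * binomialℚ N (suc j)))
    ≡⟨ cong (λ x → w 0 * ι 1 + (∑ (suc N) (λ j → w (suc j) * binomialℚ N j) + x)) lastVanishes ⟩
  w 0 * ι 1 + (∑ (suc N) (λ j → w (suc j) * binomialℚ N j) + ∑ N (λ j → w (suc j) * binomialℚ N (suc j)))
    ≡⟨ solve 3 (λ a b c → a :+ (b :+ c) := (a :+ c) :+ b) refl (w 0 * ι 1) _ _ ⟩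
  (w 0 * ι 1 + ∑ N (λ j → w (suc j) * binomialℚ N (suc j))) + ∑ (suc N) (λ j → w (suc j) * binomialℚ N j)
    ≡⟨ cong (_+ ∑ (suc N) (λ j → w (suc j) * binomialℚ N j)) (∑-suc N (λ k → w k * binomialℚ N k)) ⟨
  ∑ (suc N) (λ k → w k * binomialℚ N k) + ∑ (suc N) (λ k → w (suc k) * binomialℚ N k) ∎
  where
  pascal : ∀ j → w (suc j) * ι (binomial N j ℕ.+ binomial N (suc j)) ≡ w (suc j) * binomialℚ N j + w (suc j) * binomialℚ N (suc j)
  pascal j = trans (cong (w (suc j) *_) (ι-+ (binomial N j) (binomial N (suc j)))) (ℚP.*-distribˡ-+ (w (suc j)) _ _)
  lastVanishes : ∑ (suc N) (λ j → w (suc j) * binomialℚ N (suc j)) ≡ ∑ N (λ j → w (suc j) * binomialℚ N (suc j))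
  lastVanishes = begin
    ∑ N (λ j → w (suc j) * binomialℚ N (suc j)) + w (suc N) * ι (binomial N (suc N))
      ≡⟨ cong (λ x → ∑ N (λ j → w (suc j) * binomialℚ N (suc j)) + w (suc N) * ι x) (n<k⇒binomial≡0 (ℕP.n<1+n N)) ⟩
    ∑ N (λ j → w (suc j) * binomialℚ N (suc j)) + w (suc N) * 0ℚ
      ≡⟨ cong (∑ N (λ j → w (suc j) * binomialℚ N (suc j)) +_) (ℚP.*-zeroʳ (w (suc N))) ⟩
    ∑ N (λ j → w (suc j) * binomialℚ N (suc j)) + 0ℚ
      ≡⟨ ℚP.+-identityʳ _ ⟩
    ∑ N (λ j → w (suc j) * binomialℚ N (suc j)) ∎

∑-binomial : ∀ N → ∑ (suc N) (binomialℚ N) ≡ ι (2 ^ N)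
∑-binomial zero    = refl
∑-binomial (suc N) = begin
  ∑ (suc (suc N)) (binomialℚ (suc N))            ≡⟨ ∑-cong (suc (suc N)) (λ k _ → ℚP.*-identityˡ _) ⟨
  ∑ (suc (suc N)) (λ k → 1ℚ * binomialℚ (suc N) k) ≡⟨ ∑-binomial-pascal N (λ _ → 1ℚ) ⟩
  half + half                                     ≡⟨ cong₂ _+_ half≡2^N half≡2^N ⟩
  ι (2 ^ N) + ι (2 ^ N)                           ≡⟨ ι-+ (2 ^ N) (2 ^ N) ⟨
  ι (2 ^ N ℕ.+ 2 ^ N)                             ≡⟨ cong (λ x → ι (2 ^ N ℕ.+ x)) (ℕP.+-identityʳ (2 ^ N)) ⟨
  ι (2 ^ suc N)                                   ∎
  where
  half : ℚ
  half = ∑ (suc N) (λ k → 1ℚ * binomialℚ N k)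
  half≡2^N : half ≡ ι (2 ^ N)
  half≡2^N = trans (∑-cong (suc N) (λ k _ → ℚP.*-identityˡ _)) (∑-binomial N)

∑-alt-binomial : ∀ N → ∑ (suc (suc N)) (λ k → sgn k * binomialℚ (suc N) k) ≡ 0ℚ
∑-alt-binomial N = begin
  ∑ (suc (suc N)) (λ k → sgn k * binomialℚ (suc N) k)   ≡⟨ ∑-binomial-pascal N sgn ⟩
  A + ∑ (suc N) (λ k → sgn (suc k) * binomialℚ N k)      ≡⟨ cong (A +_) (trans (∑-cong (suc N) λ k _ → flip k) (neg-distrib-∑ (suc N) _)) ⟩
  A - A                                                 ≡⟨ ℚP.+-inverseʳ A ⟩
  0ℚ                                                    ∎
  where
  A : ℚ
  A = ∑ (suc N) (λ k → sgn k * binomialℚ N k)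
  flip : ∀ k → sgn (suc k) * binomialℚ N k ≡ - (sgn k * binomialℚ N k)
  flip k = trans (cong (_* binomialℚ N k) (sgn-suc k)) (sym (ℚP.neg-distribˡ-* (sgn k) (binomialℚ N k)))

∑-alt-binomial-shifted : ∀ N → ∑ (suc N) (λ j → sgn j * binomialℚ (suc N) (suc j)) ≡ 1ℚ
∑-alt-binomial-shifted N = begin
  X                                                         ≡⟨ solve 1 (λ x → x := con 1ℚ :+ :- (con 1ℚ :+ :- x)) refl X ⟩
  1ℚ - (1ℚ - X)                                             ≡⟨ cong (λ x → 1ℚ - (1ℚ + x)) (trans (∑-cong (suc N) λ j _ → flip j) (neg-distrib-∑ (suc N) _)) ⟨
  1ℚ - (1ℚ + ∑ (suc N) (λ j → sgn (suc j) * binomialℚ (suc N) (suc j)))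
                                                            ≡⟨ cong (λ x → 1ℚ - x) (trans (sym (∑-suc (suc N) _)) (∑-alt-binomial N)) ⟩
  1ℚ - 0ℚ                                                   ≡⟨⟩
  1ℚ                                                        ∎
  where
  X : ℚ
  X = ∑ (suc N) (λ j → sgn j * binomialℚ (suc N) (suc j))
  flip : ∀ j → sgn (suc j) * binomialℚ (suc N) (suc j) ≡ - (sgn j * binomialℚ (suc N) (suc j))
  flip j = trans (cong (_* binomialℚ (suc N) (suc j)) (sgn-suc j)) (sym (ℚP.neg-distribˡ-* (sgn j) _))

fermatQuotient2-as-* : ∀ n → fermatQuotient2 (suc n) ≡ (ι (2 ^ n) - 1ℚ) * inv (suc n)
fermatQuotient2-as-* n = trans (/-as-* (ℤ.+ (2 ^ n) ℤ.- ℤ.+ 1) n) (cong (_* inv (suc n)) (/1-homo-+ (ℤ.+ (2 ^ n)) (ℤ.- ℤ.+ 1)))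

2^[n+1]≡2+∑binomial : ∀ n → ι (2 ^ suc n) ≡ ι 2 + ∑ n (λ j → binomialℚ (suc n) (suc j))
2^[n+1]≡2+∑binomial n = begin
  ι (2 ^ suc n)                                                ≡⟨ ∑-binomial (suc n) ⟨
  ∑ (suc n) (binomialℚ (suc n)) + ι (binomial (suc n) (suc n)) ≡⟨ cong₂ _+_ (∑-suc n (binomialℚ (suc n))) (cong ι (binomial[n,n]≡1 (suc n))) ⟩
  1ℚ + T + 1ℚ                                                  ≡⟨ solve 1 (λ T → con 1ℚ :+ T :+ con 1ℚ := con (ι 2) :+ T) refl T ⟩
  ι 2 + T                                                      ∎
  where
  T : ℚ
  T = ∑ n (λ j → binomialℚ (suc n) (suc j))

2*fermatQuotient2≡∑binomial/[j+1] : ∀ n → ι 2 * fermatQuotient2 (suc n) ≡ ∑ n (λ j → binomialℚ n j * inv (suc j))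
2*fermatQuotient2≡∑binomial/[j+1] n = begin
  ι 2 * fermatQuotient2 (suc n)                   ≡⟨ cong (ι 2 *_) (fermatQuotient2-as-* n) ⟩
  ι 2 * ((ι (2 ^ n) - 1ℚ) * inv (suc n))          ≡⟨ solve 3 (λ t a i → t :* ((a :+ :- con 1ℚ) :* i) := (t :* a :+ :- t) :* i)
                                                            refl (ι 2) (ι (2 ^ n)) (inv (suc n)) ⟩
  (ι 2 * ι (2 ^ n) - ι 2) * inv (suc n)           ≡⟨ cong (λ x → (x - ι 2) * inv (suc n))
                                                          (trans (sym (ι-* 2 (2 ^ n))) (2^[n+1]≡2+∑binomial n)) ⟩
  (ι 2 + T - ι 2) * inv (suc n)                   ≡⟨ cong (_* inv (suc n)) (solve 2 (λ t T → t :+ T :+ :- t := T) refl (ι 2) T) ⟩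
  T * inv (suc n)                                 ≡⟨ ℚP.*-comm T (inv (suc n)) ⟩
  inv (suc n) * T                                 ≡⟨ *-distribˡ-∑ n (inv (suc n)) _ ⟨
  ∑ n (λ j → inv (suc n) * binomialℚ (suc n) (suc j))
                                                  ≡⟨ ∑-cong n (λ j _ → trans (ℚP.*-comm (inv (suc n)) _) (sym (binomialℚ-absorption n j))) ⟩
  ∑ n (λ j → binomialℚ n j * inv (suc j))         ∎
  where
  T : ℚ
  T = ∑ n (λ j → binomialℚ (suc n) (suc j))

inv[k^2]≡inv[k]*inv[k] : ∀ k → inv (k ^ 2) ≡ inv k * inv k
inv[k^2]≡inv[k]*inv[k] k = trans (cong (λ x → inv (k ℕ.* x)) (ℕP.*-identityʳ k)) (inv-* k k)

-- All sums below start at index 0; the k = 0 terms vanish since inv 0 = 0.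
harmonic : ℕ → ℚ
harmonic n = ∑ (suc n) inv

harmonic₂ : ℕ → ℚ
harmonic₂ n = ∑ (suc n) (λ k → inv (k ^ 2))

altHarmonic : ℕ → ℚ
altHarmonic n = ∑ (suc n) (λ k → sgn k * inv k)

altHarmonic₂ : ℕ → ℚ
altHarmonic₂ n = ∑ (suc n) (λ k → sgn k * inv (k ^ 2))

nestedHarmonic : ℕ → ℚ
nestedHarmonic n = ∑ (suc n) (λ k → harmonic k * inv k)

∑-alt-binomial/k≡harmonic : ∀ n → ∑ (suc n) (λ k → - (sgn k * inv k) * binomialℚ n k) ≡ harmonic n
∑-alt-binomial/k≡harmonic zero    = refl
∑-alt-binomial/k≡harmonic (suc N) = begin
  ∑ (suc (suc N)) (λ k → w k * binomialℚ (suc N) k)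
    ≡⟨ ∑-binomial-pascal N w ⟩
  ∑ (suc N) (λ k → w k * binomialℚ N k) + ∑ (suc N) (λ j → w (suc j) * binomialℚ N j)
    ≡⟨ cong₂ _+_ (∑-alt-binomial/k≡harmonic N) (trans (∑-cong (suc N) λ j _ → absorb j) (*-distribˡ-∑ (suc N) (inv (suc N)) _)) ⟩
  harmonic N + inv (suc N) * ∑ (suc N) (λ j → sgn j * binomialℚ (suc N) (suc j))
    ≡⟨ cong (λ x → harmonic N + inv (suc N) * x) (∑-alt-binomial-shifted N) ⟩
  harmonic N + inv (suc N) * 1ℚ
    ≡⟨ cong (harmonic N +_) (ℚP.*-identityʳ (inv (suc N))) ⟩
  harmonic (suc N) ∎
  where
  w : ℕ → ℚ
  w k = - (sgn k * inv k)
  absorb : ∀ j → w (suc j) * binomialℚ N j ≡ inv (suc N) * (sgn j * binomialℚ (suc N) (suc j))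
  absorb j = begin
    - (sgn (suc j) * inv (suc j)) * binomialℚ N j        ≡⟨ cong (λ s → - (s * inv (suc j)) * binomialℚ N j) (sgn-suc j) ⟩
    - (- sgn j * inv (suc j)) * binomialℚ N j            ≡⟨ solve 3 (λ s i b → :- ((:- s) :* i) :* b := s :* (b :* i)) refl (sgn j) (inv (suc j)) (binomialℚ N j) ⟩
    sgn j * (binomialℚ N j * inv (suc j))                ≡⟨ cong (sgn j *_) (binomialℚ-absorption N j) ⟩
    sgn j * (binomialℚ (suc N) (suc j) * inv (suc N))    ≡⟨ solve 3 (λ s b i → s :* (b :* i) := i :* (s :* b)) refl (sgn j) (binomialℚ (suc N) (suc j)) (inv (suc N)) ⟩
    inv (suc N) * (sgn j * binomialℚ (suc N) (suc j))    ∎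

∑-alt-binomial/k²≡nestedHarmonic : ∀ n → ∑ (suc n) (λ k → - (sgn k * inv (k ^ 2)) * binomialℚ n k) ≡ nestedHarmonic n
∑-alt-binomial/k²≡nestedHarmonic zero    = refl
∑-alt-binomial/k²≡nestedHarmonic (suc N) = begin
  ∑ (suc (suc N)) (λ k → w₂ k * binomialℚ (suc N) k)
    ≡⟨ ∑-binomial-pascal N w₂ ⟩
  ∑ (suc N) (λ k → w₂ k * binomialℚ N k) + ∑ (suc N) (λ j → w₂ (suc j) * binomialℚ N j)
    ≡⟨ cong₂ _+_ (∑-alt-binomial/k²≡nestedHarmonic N) (trans (∑-cong (suc N) λ j _ → absorb j) (*-distribˡ-∑ (suc N) (inv (suc N)) _)) ⟩
  nestedHarmonic N + inv (suc N) * ∑ (suc N) (λ j → w₁ (suc j) * binomialℚ (suc N) (suc j))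
    ≡⟨ cong (λ x → nestedHarmonic N + inv (suc N) * x)
         (trans (sym (trans (∑-suc (suc N) (λ k → w₁ k * binomialℚ (suc N) k)) (ℚP.+-identityˡ _))) (∑-alt-binomial/k≡harmonic (suc N))) ⟩
  nestedHarmonic N + inv (suc N) * harmonic (suc N)
    ≡⟨ cong (nestedHarmonic N +_) (ℚP.*-comm (inv (suc N)) (harmonic (suc N))) ⟩
  nestedHarmonic (suc N) ∎
  where
  w₁ w₂ : ℕ → ℚ
  w₁ k = - (sgn k * inv k)
  w₂ k = - (sgn k * inv (k ^ 2))
  absorb : ∀ j → w₂ (suc j) * binomialℚ N j ≡ inv (suc N) * (w₁ (suc j) * binomialℚ (suc N) (suc j))
  absorb j = begin
    - (sgn (suc j) * inv (suc j ^ 2)) * binomialℚ N j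
      ≡⟨ cong (λ x → - (sgn (suc j) * x) * binomialℚ N j) (inv[k^2]≡inv[k]*inv[k] (suc j)) ⟩
    - (sgn (suc j) * (inv (suc j) * inv (suc j))) * binomialℚ N j
      ≡⟨ solve 3 (λ s i b → :- (s :* (i :* i)) :* b := :- (s :* i) :* (b :* i)) refl (sgn (suc j)) (inv (suc j)) (binomialℚ N j) ⟩
    w₁ (suc j) * (binomialℚ N j * inv (suc j))
      ≡⟨ cong (w₁ (suc j) *_) (binomialℚ-absorption N j) ⟩
    w₁ (suc j) * (binomialℚ (suc N) (suc j) * inv (suc N))
      ≡⟨ solve 3 (λ w b i → w :* (b :* i) := i :* (w :* b)) refl (w₁ (suc j)) (binomialℚ (suc N) (suc j)) (inv (suc N)) ⟩
    inv (suc N) * (w₁ (suc j) * binomialℚ (suc N) (suc j)) ∎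

2*nestedHarmonic≡harmonic²+harmonic₂ : ∀ n → ι 2 * nestedHarmonic n ≡ harmonic n * harmonic n + harmonic₂ n
2*nestedHarmonic≡harmonic²+harmonic₂ zero    = refl
2*nestedHarmonic≡harmonic²+harmonic₂ (suc n) = begin
  ι 2 * (nestedHarmonic n + (harmonic n + x) * x)
    ≡⟨ cong (_* (nestedHarmonic n + (harmonic n + x) * x)) (ι-+ 1 1) ⟩
  (1ℚ + 1ℚ) * (nestedHarmonic n + (harmonic n + x) * x)
    ≡⟨ solve 3 (λ h a x → (con 1ℚ :+ con 1ℚ) :* (h :+ (a :+ x) :* x) := (con 1ℚ :+ con 1ℚ) :* h :+ ((a :+ x) :* (a :+ x) :+ x :* x :+ :- (a :* a)))
         refl (nestedHarmonic n) (harmonic n) x ⟩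
  (1ℚ + 1ℚ) * nestedHarmonic n + (harmonic (suc n) * harmonic (suc n) + x * x - harmonic n * harmonic n)
    ≡⟨ cong (λ t → t * nestedHarmonic n + (harmonic (suc n) * harmonic (suc n) + x * x - harmonic n * harmonic n)) (ι-+ 1 1) ⟨
  ι 2 * nestedHarmonic n + (harmonic (suc n) * harmonic (suc n) + x * x - harmonic n * harmonic n)
    ≡⟨ cong₂ (λ u v → u + (harmonic (suc n) * harmonic (suc n) + v - harmonic n * harmonic n))
         (2*nestedHarmonic≡harmonic²+harmonic₂ n) (sym (inv[k^2]≡inv[k]*inv[k] (suc n))) ⟩
  harmonic n * harmonic n + harmonic₂ n + (harmonic (suc n) * harmonic (suc n) + inv (suc n ^ 2) - harmonic n * harmonic n)
    ≡⟨ solve 4 (λ a h b q → a :+ h :+ (b :+ q :+ :- a) := b :+ (h :+ q))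
         refl (harmonic n * harmonic n) (harmonic₂ n) (harmonic (suc n) * harmonic (suc n)) (inv (suc n ^ 2)) ⟩
  harmonic (suc n) * harmonic (suc n) + harmonic₂ (suc n) ∎
  where
  x : ℚ
  x = inv (suc n)

invBinomial-split : ∀ {N j} → j ≤ N →
  invBinomial N j ≡ ι (suc N) * inv (suc (suc N)) * (invBinomial (suc N) j + invBinomial (suc N) (suc j))
invBinomial-split {N} {j} j≤N = sym (begin
  c * (invBinomial (suc N) j + invBinomial (suc N) (suc j))
    ≡⟨ cong₂ (λ u v → c * (u + v)) (invBinomial-suc j≤N) (invBinomial-suc-suc j≤N) ⟩
  c * (B - ι j * i * B + ι (suc j) * i * B)
    ≡⟨ cong (λ u → c * (B - ι j * i * B + u * i * B)) (ι-+ 1 j) ⟩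
  c * (B - ι j * i * B + (1ℚ + ι j) * i * B)
    ≡⟨ solve 5 (λ a b i B J → a :* b :* (B :+ :- (J :* i :* B) :+ (con 1ℚ :+ J) :* i :* B) := B :* (b :* (a :* i :+ a)))
         refl (ι (suc N)) (inv (suc (suc N))) i B (ι j) ⟩
  B * (inv (suc (suc N)) * (ι (suc N) * i + ι (suc N)))
    ≡⟨ cong (λ u → B * (inv (suc (suc N)) * (u + ι (suc N)))) (ι*inv≡1 (suc N) λ ()) ⟩
  B * (inv (suc (suc N)) * (1ℚ + ι (suc N)))
    ≡⟨ cong (λ u → B * (inv (suc (suc N)) * u)) (ι-+ 1 (suc N)) ⟨
  B * (inv (suc (suc N)) * ι (suc (suc N)))
    ≡⟨ cong (B *_) (trans (ℚP.*-comm (inv (suc (suc N))) _) (ι*inv≡1 (suc (suc N)) λ ())) ⟩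
  B * 1ℚ
    ≡⟨ ℚP.*-identityʳ B ⟩
  B ∎)
  where
  c B i : ℚ
  c = ι (suc N) * inv (suc (suc N))
  B = invBinomial N j
  i = inv (suc N)

∑-alt-invBinomial : ∀ N → ∑ (suc N) (λ j → sgn j * invBinomial N j) ≡ ι (suc N) * inv (suc (suc N)) * (1ℚ + sgn N)
∑-alt-invBinomial N = begin
  ∑ (suc N) (λ j → sgn j * invBinomial N j)
    ≡⟨ ∑-cong (suc N) (λ j j<1+N → trans (cong (sgn j *_) (invBinomial-split (ℕP.≤-pred j<1+N)))
                                         (solve 3 (λ s c x → s :* (c :* x) := c :* (s :* x)) refl (sgn j) c _)) ⟩
  ∑ (suc N) (λ j → c * (sgn j * (u j + u (suc j))))
    ≡⟨ *-distribˡ-∑ (suc N) c _ ⟩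
  c * ∑ (suc N) (λ j → sgn j * (u j + u (suc j)))
    ≡⟨ cong (c *_) (∑-alt-telescope (suc N) u) ⟩
  c * (u 0 - sgn (suc N) * u (suc N))
    ≡⟨ cong₂ (λ s v → c * (u 0 - s * v)) (sgn-suc N) (cong inv (binomial[n,n]≡1 (suc N))) ⟩
  c * (1ℚ - (- sgn N) * 1ℚ)
    ≡⟨ cong (c *_) (solve 1 (λ s → con 1ℚ :+ :- ((:- s) :* con 1ℚ) := con 1ℚ :+ s) refl (sgn N)) ⟩
  c * (1ℚ + sgn N) ∎
  where
  c : ℚ
  c = ι (suc N) * inv (suc (suc N))
  u : ℕ → ℚ
  u = invBinomial (suc N)

∑-alt-invBinomial/k : ∀ m → ∑ (suc m) (λ k → sgn k * inv k * invBinomial m k) ≡ - (1ℚ - sgn m) * inv (suc m)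
∑-alt-invBinomial/k zero    = refl
∑-alt-invBinomial/k (suc m) = begin
  ∑ (suc (suc m)) (λ k → sgn k * inv k * invBinomial (suc m) k)
    ≡⟨ ∑-suc (suc m) _ ⟩
  0ℚ + ∑ (suc m) (λ k → sgn (suc k) * inv (suc k) * invBinomial (suc m) (suc k))
    ≡⟨ trans (ℚP.+-identityˡ _) (∑-cong (suc m) λ k _ → shift k) ⟩
  ∑ (suc m) (λ k → - i * (sgn k * invBinomial m k))
    ≡⟨ *-distribˡ-∑ (suc m) (- i) _ ⟩
  - i * ∑ (suc m) (λ k → sgn k * invBinomial m k)
    ≡⟨ cong (- i *_) (∑-alt-invBinomial m) ⟩
  - i * (ι (suc m) * inv (suc (suc m)) * (1ℚ + sgn m))
    ≡⟨ solve 4 (λ i a j s → :- i :* (a :* j :* (con 1ℚ :+ s)) := :- (a :* i) :* (j :* (con 1ℚ :+ s))) refl i (ι (suc m)) (inv (suc (suc m))) (sgn m) ⟩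
  - (ι (suc m) * i) * (inv (suc (suc m)) * (1ℚ + sgn m))
    ≡⟨ cong (λ x → - x * (inv (suc (suc m)) * (1ℚ + sgn m))) (ι*inv≡1 (suc m) λ ()) ⟩
  - 1ℚ * (inv (suc (suc m)) * (1ℚ + sgn m))
    ≡⟨ cong (λ s → - 1ℚ * (inv (suc (suc m)) * (1ℚ + s))) (trans (sym (⁻¹-involutive (sgn m))) (cong -_ (sym (sgn-suc m)))) ⟩
  - 1ℚ * (inv (suc (suc m)) * (1ℚ - sgn (suc m)))
    ≡⟨ solve 2 (λ j s → :- con 1ℚ :* (j :* (con 1ℚ :+ :- s)) := :- (con 1ℚ :+ :- s) :* j) refl (inv (suc (suc m))) (sgn (suc m)) ⟩
  - (1ℚ - sgn (suc m)) * inv (suc (suc m)) ∎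
  where
  i : ℚ
  i = inv (suc m)
  shift : ∀ k → sgn (suc k) * inv (suc k) * invBinomial (suc m) (suc k) ≡ - i * (sgn k * invBinomial m k)
  shift k = begin
    sgn (suc k) * inv (suc k) * invBinomial (suc m) (suc k)    ≡⟨ ℚP.*-assoc (sgn (suc k)) _ _ ⟩
    sgn (suc k) * (inv (suc k) * invBinomial (suc m) (suc k))  ≡⟨ cong₂ _*_ (sgn-suc k) (inv*invBinomial-suc m k) ⟩
    - sgn k * (i * invBinomial m k)                            ≡⟨ solve 3 (λ s i b → :- s :* (i :* b) := :- i :* (s :* b)) refl (sgn k) i (invBinomial m k) ⟩
    - i * (sgn k * invBinomial m k)                            ∎

inv[k^2]*ι[k]≡inv[k] : ∀ k → inv (k ^ 2) * ι k ≡ inv k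
inv[k^2]*ι[k]≡inv[k] zero    = refl
inv[k^2]*ι[k]≡inv[k] (suc k) = begin
  inv (suc k ^ 2) * ι (suc k)                 ≡⟨ cong (_* ι (suc k)) (inv[k^2]≡inv[k]*inv[k] (suc k)) ⟩
  inv (suc k) * inv (suc k) * ι (suc k)       ≡⟨ solve 2 (λ i x → i :* i :* x := i :* (x :* i)) refl (inv (suc k)) (ι (suc k)) ⟩
  inv (suc k) * (ι (suc k) * inv (suc k))     ≡⟨ cong (inv (suc k) *_) (ι*inv≡1 (suc k) λ ()) ⟩
  inv (suc k) * 1ℚ                            ≡⟨ ℚP.*-identityʳ _ ⟩
  inv (suc k)                                 ∎

altInvBinomialSum₂ : ℕ → ℚ
altInvBinomialSum₂ m = ∑ (suc m) (λ k → sgn k * inv (k ^ 2) * invBinomial m k)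

altInvBinomialSum₂≡harmonic₂+2*altHarmonic₂ : ∀ m → altInvBinomialSum₂ m ≡ harmonic₂ m + ι 2 * altHarmonic₂ m
altInvBinomialSum₂≡harmonic₂+2*altHarmonic₂ zero    = refl
altInvBinomialSum₂≡harmonic₂+2*altHarmonic₂ (suc m) = begin
  ∑ (suc m) (λ k → sgn k * inv (k ^ 2) * invBinomial (suc m) k) + sgn (suc m) * q * invBinomial (suc m) (suc m)
    ≡⟨ cong₂ _+_ (∑-cong (suc m) λ k k<1+m → raise (ℕP.≤-pred k<1+m))
                 (cong (λ x → sgn (suc m) * q * inv x) (binomial[n,n]≡1 (suc m))) ⟩
  ∑ (suc m) (λ k → sgn k * inv (k ^ 2) * invBinomial m k + - i * (sgn k * inv k * invBinomial m k)) + sgn (suc m) * q * 1ℚ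
    ≡⟨ cong (_+ sgn (suc m) * q * 1ℚ) (trans (∑-distrib-+ (suc m) _ _) (cong (altInvBinomialSum₂ m +_) (*-distribˡ-∑ (suc m) (- i) _))) ⟩
  altInvBinomialSum₂ m + - i * ∑ (suc m) (λ k → sgn k * inv k * invBinomial m k) + sgn (suc m) * q * 1ℚ
    ≡⟨ cong₂ (λ F G → F + - i * G + sgn (suc m) * q * 1ℚ)
             (altInvBinomialSum₂≡harmonic₂+2*altHarmonic₂ m) (∑-alt-invBinomial/k m) ⟩
  harmonic₂ m + ι 2 * altHarmonic₂ m + - i * (- (1ℚ - sgn m) * i) + sgn (suc m) * q * 1ℚ
    ≡⟨ cong₂ (λ s x → harmonic₂ m + ι 2 * altHarmonic₂ m + - i * (- (1ℚ - s) * i) + sgn (suc m) * x * 1ℚ)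
             (trans (sym (⁻¹-involutive (sgn m))) (cong -_ (sym (sgn-suc m)))) (inv[k^2]≡inv[k]*inv[k] (suc m)) ⟩
  harmonic₂ m + ι 2 * altHarmonic₂ m + - i * (- (1ℚ - - sgn (suc m)) * i) + sgn (suc m) * (i * i) * 1ℚ
    ≡⟨ cong (λ t → harmonic₂ m + t * altHarmonic₂ m + - i * (- (1ℚ - - sgn (suc m)) * i) + sgn (suc m) * (i * i) * 1ℚ) (ι-+ 1 1) ⟩
  harmonic₂ m + (1ℚ + 1ℚ) * altHarmonic₂ m + - i * (- (1ℚ - - sgn (suc m)) * i) + sgn (suc m) * (i * i) * 1ℚ
    ≡⟨ solve 4 (λ h a i s → h :+ (con 1ℚ :+ con 1ℚ) :* a :+ :- i :* (:- (con 1ℚ :+ :- (:- s)) :* i) :+ s :* (i :* i) :* con 1ℚ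
                          := h :+ i :* i :+ (con 1ℚ :+ con 1ℚ) :* (a :+ s :* (i :* i)))
         refl (harmonic₂ m) (altHarmonic₂ m) i (sgn (suc m)) ⟩
  harmonic₂ m + i * i + (1ℚ + 1ℚ) * (altHarmonic₂ m + sgn (suc m) * (i * i))
    ≡⟨ cong₂ (λ x t → harmonic₂ m + x + t * (altHarmonic₂ m + sgn (suc m) * x))
             (sym (inv[k^2]≡inv[k]*inv[k] (suc m))) (sym (ι-+ 1 1)) ⟩
  harmonic₂ (suc m) + ι 2 * altHarmonic₂ (suc m) ∎
  where
  i q : ℚ
  i = inv (suc m)
  q = inv (suc m ^ 2)
  raise : ∀ {k} → k ≤ m → sgn k * inv (k ^ 2) * invBinomial (suc m) k
                        ≡ sgn k * inv (k ^ 2) * invBinomial m k + - i * (sgn k * inv k * invBinomial m k)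
  raise {k} k≤m = begin
    sgn k * inv (k ^ 2) * invBinomial (suc m) k
      ≡⟨ cong (sgn k * inv (k ^ 2) *_) (invBinomial-suc k≤m) ⟩
    sgn k * inv (k ^ 2) * (invBinomial m k - ι k * i * invBinomial m k)
      ≡⟨ solve 5 (λ s q b x i → s :* q :* (b :+ :- (x :* i :* b)) := s :* q :* b :+ :- i :* (s :* (q :* x) :* b))
           refl (sgn k) (inv (k ^ 2)) (invBinomial m k) (ι k) i ⟩
    sgn k * inv (k ^ 2) * invBinomial m k + - i * (sgn k * (inv (k ^ 2) * ι k) * invBinomial m k)
      ≡⟨ cong (λ x → sgn k * inv (k ^ 2) * invBinomial m k + - i * (sgn k * x * invBinomial m k)) (inv[k^2]*ι[k]≡inv[k] k) ⟩
    sgn k * inv (k ^ 2) * invBinomial m k + - i * (sgn k * inv k * invBinomial m k) ∎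

-- Evaluation of S

sumFromTo-alt-invBinomial : ∀ {k n} → k ≤ n →
  sumFromTo k n (λ m → sgn (m ∸ k) * inv (m C k)) ≡ ∑ (suc n) (λ m → sgn (m ∸ k) * invBinomial m k)
sumFromTo-alt-invBinomial {k} k≤n with ℕP.m≤n⇒∃[o]m+o≡n k≤n
... | t , refl = begin
  sumFromTo k (k ℕ.+ t) (λ m → sgn (m ∸ k) * inv (m C k))
    ≡⟨ sumFromTo-∑ k t _ ⟩
  ∑ (suc t) (λ i → sgn (k ℕ.+ i ∸ k) * inv ((k ℕ.+ i) C k))
    ≡⟨ ∑-cong (suc t) (λ i _ → cong (λ x → sgn (k ℕ.+ i ∸ k) * inv x) (C≡binomial (k ℕ.+ i) k)) ⟩
  ∑ (suc t) (λ i → f (k ℕ.+ i))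
    ≡⟨ ℚP.+-identityˡ _ ⟨
  0ℚ + ∑ (suc t) (λ i → f (k ℕ.+ i))
    ≡⟨ cong (_+ ∑ (suc t) (λ i → f (k ℕ.+ i))) (∑-zero k λ m m<k → vanish m<k) ⟨
  ∑ k f + ∑ (suc t) (λ i → f (k ℕ.+ i))
    ≡⟨ ∑-+ k (suc t) f ⟨
  ∑ (k ℕ.+ suc t) f
    ≡⟨ cong (λ x → ∑ x f) (ℕP.+-suc k t) ⟩
  ∑ (suc (k ℕ.+ t)) f ∎
  where
  f : ℕ → ℚ
  f m = sgn (m ∸ k) * invBinomial m k
  vanish : ∀ {m} → m < k → f m ≡ 0ℚ
  vanish {m} m<k = trans (cong (λ x → sgn (m ∸ k) * inv x) (n<k⇒binomial≡0 m<k)) (ℚP.*-zeroʳ (sgn (m ∸ k)))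

-- The summand of S, indexed by (m, k) as after interchanging the two sums.
summand : ℕ → ℕ → ℚ
summand m k = inv (k ^ 2) * (sgn (m ∸ k) * invBinomial m k)

summand[m,1] : ∀ m → summand m 1 ≡ - (sgn m * inv m)
summand[m,1] zero    = refl
summand[m,1] (suc m) = begin
  1ℚ * (sgn m * inv (binomial (suc m) 1))   ≡⟨ cong (λ x → 1ℚ * (sgn m * inv x)) (binomial[n,1]≡n (suc m)) ⟩
  1ℚ * (sgn m * inv (suc m))                ≡⟨ solve 2 (λ s i → con 1ℚ :* (s :* i) := :- (:- s :* i)) refl (sgn m) (inv (suc m)) ⟩
  - (- sgn m * inv (suc m))                 ≡⟨ cong (λ s → - (s * inv (suc m))) (sgn-suc m) ⟨
  - (sgn (suc m) * inv (suc m))             ∎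

∑-summand≡sgn*altInvBinomialSum₂ : ∀ m → ∑ (suc m) (summand m) ≡ sgn m * altInvBinomialSum₂ m
∑-summand≡sgn*altInvBinomialSum₂ m = trans (∑-cong (suc m) λ k k<1+m → pull (ℕP.≤-pred k<1+m)) (*-distribˡ-∑ (suc m) (sgn m) _)
  where
  pull : ∀ {k} → k ≤ m → summand m k ≡ sgn m * (sgn k * inv (k ^ 2) * invBinomial m k)
  pull {k} k≤m = trans (cong (λ s → inv (k ^ 2) * (s * invBinomial m k)) (sgn-∸ k≤m))
    (solve 4 (λ q a b c → q :* (a :* b :* c) := a :* (b :* q :* c)) refl (inv (k ^ 2)) (sgn m) (sgn k) (invBinomial m k))

∑-summand-from-2 : ∀ {m} t → m ≤ suc (suc t) → ∑ (suc t) (λ i → summand m (2 ℕ.+ i)) ≡ sgn m * (altInvBinomialSum₂ m + inv m)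
∑-summand-from-2 {m} t m≤2+t = begin
  X                                   ≡⟨ solve 2 (λ a x → x := a :+ x :+ :- a) refl (∑ 2 (summand m)) X ⟩
  ∑ 2 (summand m) + X - ∑ 2 (summand m)     ≡⟨ cong (_- ∑ 2 (summand m)) (∑-+ 2 (suc t) (summand m)) ⟨
  ∑ (3 ℕ.+ t) (summand m) - ∑ 2 (summand m) ≡⟨ cong₂ _-_ (trans (∑-vanishing-tail (3 ℕ.+ t) (summand m) vanish (s≤s m≤2+t))
                                                         (∑-summand≡sgn*altInvBinomialSum₂ m))
                                                  first-two ⟩
  sgn m * altInvBinomialSum₂ m - - (sgn m * inv m)
                                      ≡⟨ solve 3 (λ s F i → s :* F :+ :- (:- (s :* i)) := s :* (F :+ i)) refl (sgn m) (altInvBinomialSum₂ m) (inv m) ⟩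
  sgn m * (altInvBinomialSum₂ m + inv m) ∎
  where
  X : ℚ
  X = ∑ (suc t) (λ i → summand m (2 ℕ.+ i))
  vanish : ∀ k → suc m ≤ k → summand m k ≡ 0ℚ
  vanish k m<k = begin
    inv (k ^ 2) * (sgn (m ∸ k) * inv (binomial m k))  ≡⟨ cong (λ x → inv (k ^ 2) * (sgn (m ∸ k) * inv x)) (n<k⇒binomial≡0 m<k) ⟩
    inv (k ^ 2) * (sgn (m ∸ k) * 0ℚ)                 ≡⟨ cong (inv (k ^ 2) *_) (ℚP.*-zeroʳ (sgn (m ∸ k))) ⟩
    inv (k ^ 2) * 0ℚ                                 ≡⟨ ℚP.*-zeroʳ (inv (k ^ 2)) ⟩
    0ℚ                                               ∎
  first-two : ∑ 2 (summand m) ≡ - (sgn m * inv m)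
  first-two = begin
    0ℚ + summand m 0 + summand m 1  ≡⟨ cong₂ (λ x y → 0ℚ + x + y) (ℚP.*-zeroˡ (sgn m * invBinomial m 0)) (summand[m,1] m) ⟩
    0ℚ + 0ℚ + - (sgn m * inv m) ≡⟨ ℚP.+-identityˡ _ ⟩
    - (sgn m * inv m)         ∎

S≡∑-sgn*[altInvBinomialSum₂+inv] : ∀ t → S (3 ℕ.+ t) ≡ ∑ (3 ℕ.+ t) (λ m → sgn m * (altInvBinomialSum₂ m + inv m))
S≡∑-sgn*[altInvBinomialSum₂+inv] t = begin
  S (suc N)
    ≡⟨ sumFromTo-∑ 2 t _ ⟩
  ∑ (suc t) (λ i → inv ((2 ℕ.+ i) ^ 2) * sumFromTo (2 ℕ.+ i) N (λ m → sgn (m ∸ (2 ℕ.+ i)) * inv (m C (2 ℕ.+ i))))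
    ≡⟨ ∑-cong (suc t) (λ i i<1+t → trans (cong (inv ((2 ℕ.+ i) ^ 2) *_) (sumFromTo-alt-invBinomial (s≤s (s≤s (ℕP.≤-pred i<1+t)))))
                                         (sym (*-distribˡ-∑ (suc N) (inv ((2 ℕ.+ i) ^ 2)) _))) ⟩
  ∑ (suc t) (λ i → ∑ (suc N) (λ m → summand m (2 ℕ.+ i)))
    ≡⟨ ∑-comm (suc t) (suc N) (λ i m → summand m (2 ℕ.+ i)) ⟩
  ∑ (suc N) (λ m → ∑ (suc t) (λ i → summand m (2 ℕ.+ i)))
    ≡⟨ ∑-cong (suc N) (λ m m<1+N → ∑-summand-from-2 t (ℕP.≤-pred m<1+N)) ⟩
  ∑ (suc N) (λ m → sgn m * (altInvBinomialSum₂ m + inv m)) ∎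
  where
  N : ℕ
  N = suc (suc t)

altSum : ℕ → ℚ
altSum n = ∑ (suc n) (λ m → sgn m * (harmonic₂ m + ι 2 * altHarmonic₂ m))

S≡altSum+altHarmonic : ∀ t → S (3 ℕ.+ t) ≡ altSum (2 ℕ.+ t) + altHarmonic (2 ℕ.+ t)
S≡altSum+altHarmonic t = begin
  S (3 ℕ.+ t)
    ≡⟨ S≡∑-sgn*[altInvBinomialSum₂+inv] t ⟩
  ∑ (3 ℕ.+ t) (λ m → sgn m * (altInvBinomialSum₂ m + inv m))
    ≡⟨ ∑-cong (3 ℕ.+ t) (λ m _ → trans (cong (λ F → sgn m * (F + inv m)) (altInvBinomialSum₂≡harmonic₂+2*altHarmonic₂ m))
                                          (ℚP.*-distribˡ-+ (sgn m) _ (inv m))) ⟩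
  ∑ (3 ℕ.+ t) (λ m → sgn m * (harmonic₂ m + ι 2 * altHarmonic₂ m) + sgn m * inv m)
    ≡⟨ ∑-distrib-+ (3 ℕ.+ t) _ _ ⟩
  altSum (2 ℕ.+ t) + altHarmonic (2 ℕ.+ t) ∎

2*altSum≡3*[harmonic₂+altHarmonic₂] : ∀ n → sgn n ≡ 1ℚ → ι 2 * altSum n ≡ ι 3 * (harmonic₂ n + altHarmonic₂ n)
2*altSum≡3*[harmonic₂+altHarmonic₂] zero          _     = refl
2*altSum≡3*[harmonic₂+altHarmonic₂] (suc zero)    ()
2*altSum≡3*[harmonic₂+altHarmonic₂] (suc (suc n)) sgn≡1 = begin
  ι 2 * altSum (suc (suc n))
    ≡⟨ cong₂ lhs sgn[1+n]≡-1 sgn≡1 ⟩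
  lhs (- 1ℚ) 1ℚ
    ≡⟨ solve 5 (λ E H A q₁ q₂ →
         con (ι 2) :* (E :+ :- con 1ℚ :* (H :+ q₁ :+ con (ι 2) :* (A :+ :- con 1ℚ :* q₁))
                         :+ con 1ℚ :* (H :+ q₁ :+ q₂ :+ con (ι 2) :* (A :+ :- con 1ℚ :* q₁ :+ con 1ℚ :* q₂)))
         := con (ι 2) :* E :+ con (ι 6) :* q₂) refl (altSum n) H A q₁ q₂ ⟩
  ι 2 * altSum n + ι 6 * q₂
    ≡⟨ cong (_+ ι 6 * q₂) (2*altSum≡3*[harmonic₂+altHarmonic₂] n sgn≡1) ⟩
  ι 3 * (H + A) + ι 6 * q₂
    ≡⟨ solve 4 (λ H A q₁ q₂ → con (ι 3) :* (H :+ A) :+ con (ι 6) :* q₂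
                            := con (ι 3) :* (H :+ q₁ :+ q₂ :+ (A :+ :- con 1ℚ :* q₁ :+ con 1ℚ :* q₂))) refl H A q₁ q₂ ⟩
  rhs (- 1ℚ) 1ℚ
    ≡⟨ cong₂ rhs sgn[1+n]≡-1 sgn≡1 ⟨
  ι 3 * (harmonic₂ (suc (suc n)) + altHarmonic₂ (suc (suc n))) ∎
  where
  -- lhs and rhs abstract the signs of 1 + n and 2 + n, which are -1 and 1.
  H A q₁ q₂ : ℚ
  H = harmonic₂ n
  A = altHarmonic₂ n
  q₁ = inv (suc n ^ 2)
  q₂ = inv (suc (suc n) ^ 2)
  sgn[1+n]≡-1 : sgn (suc n) ≡ - 1ℚ
  sgn[1+n]≡-1 = trans (sgn-suc n) (cong -_ sgn≡1)
  lhs rhs : ℚ → ℚ → ℚ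
  lhs a b = ι 2 * (altSum n + a * (H + q₁ + ι 2 * (A + a * q₁)) + b * (H + q₁ + q₂ + ι 2 * (A + a * q₁ + b * q₂)))
  rhs a b = ι 3 * (H + q₁ + q₂ + (A + a * q₁ + b * q₂))

-- p-integral rationals

module PIntegral {p : ℕ} (prime : Prime p) where

  Integral : ℚ → Set
  Integral x = ¬ (ℤ.+ p ∣ℤ ↧ x)

  Divisible : ℚ → Set
  Divisible x = (ℤ.+ p ∣ℤ ↥ x) × Integral x

  private
    p∣ℤ-euclid : ∀ a b → ℤ.+ p ∣ℤ a ℤ.* b → ℤ.+ p ∣ℤ a ⊎ ℤ.+ p ∣ℤ b
    p∣ℤ-euclid a b p∣ab with euclidsLemma ℤ.∣ a ∣ ℤ.∣ b ∣ prime (subst (p ∣_) (ℤP.abs-* a b) (∣⇒∣ᵤ p∣ab))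
    ... | inj₁ p∣a = inj₁ (∣ᵤ⇒∣ p∣a)
    ... | inj₂ p∣b = inj₂ (∣ᵤ⇒∣ p∣b)

    p∤ℤ-* : ∀ a b → ¬ ℤ.+ p ∣ℤ a → ¬ ℤ.+ p ∣ℤ b → ¬ ℤ.+ p ∣ℤ a ℤ.* b
    p∤ℤ-* a b p∤a p∤b p∣ab with p∣ℤ-euclid a b p∣ab
    ... | inj₁ p∣a = p∤a p∣a
    ... | inj₂ p∣b = p∤b p∣b

    p∣ℤ-cancel : ∀ a g b → a ℤ.* g ≡ b → ℤ.+ p ∣ℤ b → ¬ ℤ.+ p ∣ℤ g → ℤ.+ p ∣ℤ a
    p∣ℤ-cancel a g b refl p∣ag p∤g with p∣ℤ-euclid a g p∣ag
    ... | inj₁ p∣a = p∣a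
    ... | inj₂ p∣g = contradiction p∣g p∤g

    p∤ℤ-factorˡ : ∀ a g b → a ℤ.* g ≡ b → ¬ ℤ.+ p ∣ℤ b → ¬ ℤ.+ p ∣ℤ a
    p∤ℤ-factorˡ a g b refl p∤ag p∣a = p∤ag (ℤ∣.∣m⇒∣m*n g p∣a)

    p∤ℤ-factorʳ : ∀ a g b → a ℤ.* g ≡ b → ¬ ℤ.+ p ∣ℤ b → ¬ ℤ.+ p ∣ℤ g
    p∤ℤ-factorʳ a g b refl p∤ag p∣g = p∤ag (ℤ∣.∣n⇒∣m*n a p∣g)

  1<p : 1 < p
  1<p = ℕ.nonTrivial⇒n>1 p {{prime⇒nonTrivial prime}}

  p∤k : ∀ {k} → 0 < k → k < p → ¬ p ∣ k
  p∤k {suc k} _ k<p p∣k = ℕP.<⇒≱ k<p (∣⇒≤ p∣k)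

  integral-+ : ∀ x y → Integral x → Integral y → Integral (x + y)
  integral-+ x@record{} y@record{} ix iy = p∤ℤ-factorˡ (↧ (x + y)) _ _ (ℚP.↧-+ x y) (p∤ℤ-* (↧ x) (↧ y) ix iy)

  integral-* : ∀ x y → Integral x → Integral y → Integral (x * y)
  integral-* x@record{} y@record{} ix iy = p∤ℤ-factorˡ (↧ (x * y)) _ _ (ℚP.↧-* x y) (p∤ℤ-* (↧ x) (↧ y) ix iy)

  integral-neg : ∀ x → Integral x → Integral (- x)
  integral-neg x ix = subst (λ d → ¬ ℤ.+ p ∣ℤ d) (sym (ℚP.↧-neg x)) ix

  divisible-+ : ∀ x y → Divisible x → Divisible y → Divisible (x + y)
  divisible-+ x@record{} y@record{} (p∣x , ix) (p∣y , iy) =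
    p∣ℤ-cancel _ _ _ (ℚP.↥-+ x y) (ℤ∣.∣m∣n⇒∣m+n (ℤ∣.∣m⇒∣m*n (↧ y) p∣x) (ℤ∣.∣m⇒∣m*n (↧ x) p∣y))
                     (p∤ℤ-factorʳ (↧ (x + y)) _ _ (ℚP.↧-+ x y) (p∤ℤ-* (↧ x) (↧ y) ix iy))
    , integral-+ x y ix iy

  divisible*integral : ∀ x y → Divisible x → Integral y → Divisible (x * y)
  divisible*integral x@record{} y@record{} (p∣x , ix) iy =
    p∣ℤ-cancel _ _ _ (ℚP.↥-* x y) (ℤ∣.∣m⇒∣m*n (↥ y) p∣x)
                     (p∤ℤ-factorʳ (↧ (x * y)) _ _ (ℚP.↧-* x y) (p∤ℤ-* (↧ x) (↧ y) ix iy))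
    , integral-* x y ix iy

  integral*divisible : ∀ x y → Integral x → Divisible y → Divisible (x * y)
  integral*divisible x y ix dy = subst Divisible (ℚP.*-comm y x) (divisible*integral y x dy ix)

  divisible-neg : ∀ x → Divisible x → Divisible (- x)
  divisible-neg x (p∣x , ix) = subst (ℤ.+ p ∣ℤ_) (sym (ℚP.↥-neg x)) (ℤ∣.∣m⇒∣-m p∣x) , integral-neg x ix

  divisible-- : ∀ x y → Divisible x → Divisible y → Divisible (x - y)
  divisible-- x y dx dy = divisible-+ x (- y) dx (divisible-neg y dy)

  integral-∑ : ∀ n f → (∀ i → i < n → Integral (f i)) → Integral (∑ n f)
  integral-∑ zero    f _  = λ p∣1 → p∤k (s≤s z≤n) 1<p (∣⇒∣ᵤ p∣1)
  integral-∑ (suc n) f if = integral-+ (∑ n f) (f n) (integral-∑ n f λ i i<n → if i (ℕP.m<n⇒m<1+n i<n)) (if n ℕP.≤-refl)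

  divisible-∑ : ∀ n f → (∀ i → i < n → Divisible (f i)) → Divisible (∑ n f)
  divisible-∑ zero    f _  = ℤ∣.divides (ℤ.+ 0) refl , integral-∑ zero f (λ _ ())
  divisible-∑ (suc n) f df = divisible-+ (∑ n f) (f n) (divisible-∑ n f λ i i<n → df i (ℕP.m<n⇒m<1+n i<n)) (df n ℕP.≤-refl)

  integral-/ : ∀ i d .{{_ : ℕ.NonZero d}} → ¬ p ∣ d → Integral (i / d)
  integral-/ i d p∤d p∣↧ = p∤d (∣⇒∣ᵤ (subst (ℤ.+ p ∣ℤ_) (ℚP.↧-/ i d) (ℤ∣.∣m⇒∣m*n _ p∣↧)))

  divisible-/ : ∀ i d .{{_ : ℕ.NonZero d}} → ℤ.+ p ∣ℤ i → ¬ p ∣ d → Divisible (i / d)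
  divisible-/ i d p∣i p∤d =
    p∣ℤ-cancel (↥ (i / d)) _ _ (ℚP.↥-/ i d) p∣i (p∤ℤ-factorʳ (↧ (i / d)) _ _ (ℚP.↧-/ i d) (p∤d ∘ ∣⇒∣ᵤ))
    , integral-/ i d p∤d

  integral-ι : ∀ m → Integral (ι m)
  integral-ι m = integral-/ (ℤ.+ m) 1 (p∤k (s≤s z≤n) 1<p)

  divisible-ι : ∀ {m} → p ∣ m → Divisible (ι m)
  divisible-ι {m} p∣m = divisible-/ (ℤ.+ m) 1 (∣ᵤ⇒∣ p∣m) (p∤k (s≤s z≤n) 1<p)

  integral-inv-p∤ : ∀ {k} → ¬ p ∣ k → Integral (inv k)
  integral-inv-p∤ {zero}  p∤0 = contradiction (divides 0 refl) p∤0
  integral-inv-p∤ {suc k} p∤k = integral-/ (ℤ.+ 1) (suc k) p∤k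

  integral-inv : ∀ {k} → k < p → Integral (inv k)
  integral-inv {zero}  _   = integral-ι 0
  integral-inv {suc k} k<p = integral-inv-p∤ (p∤k (s≤s z≤n) k<p)

  integral-sgn : ∀ k → Integral (sgn k)
  integral-sgn zero          = integral-ι 1
  integral-sgn (suc zero)    = integral-neg 1ℚ (integral-ι 1)
  integral-sgn (suc (suc k)) = integral-sgn k

  divisible-cancel-ι : ∀ {k} x → 0 < k → k < p → Divisible (ι k * x) → Divisible x
  divisible-cancel-ι {k} x 0<k k<p d = subst Divisible inv*[ι*x]≡x (integral*divisible (inv k) (ι k * x) (integral-inv k<p) d)
    where
    inv*[ι*x]≡x : inv k * (ι k * x) ≡ x
    inv*[ι*x]≡x = begin
      inv k * (ι k * x)  ≡⟨ ℚP.*-assoc (inv k) (ι k) x ⟨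
      inv k * ι k * x    ≡⟨ cong (_* x) (trans (ℚP.*-comm (inv k) (ι k)) (ι*inv≡1 k (ℕP.n>0⇒n≢0 0<k))) ⟩
      1ℚ * x             ≡⟨ ℚP.*-identityˡ x ⟩
      x                  ∎

  divisible⇒≡[modℚ] : ∀ {x y} → Divisible (x - y) → x ≡ y [modℚ p ]
  divisible⇒≡[modℚ] (p∣↥ , p∤↧) = ∣⇒∣ᵤ p∣↥ , p∤↧ ∘ ∣ᵤ⇒∣

  ¬divisible-sgn : ∀ k → ¬ Divisible (sgn k)
  ¬divisible-sgn k d with divisible*integral (sgn k) (sgn k) d (integral-sgn k)
  ... | p∣↥sgn² , _ = p∤k (s≤s z≤n) 1<p (∣⇒∣ᵤ (subst (λ x → ℤ.+ p ∣ℤ ↥ x) (sgn*sgn≡1 k) p∣↥sgn²))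

-- Congruences modulo p

module Congruences {n : ℕ} (prime : Prime (suc n)) (2<p : 2 < suc n) where

  open PIntegral prime

  p∣binomial[p,j+1] : ∀ {j} → suc j ≤ n → suc n ∣ binomial (suc n) (suc j)
  p∣binomial[p,j+1] {j} j<n
    with euclidsLemma (suc j) (binomial (suc n) (suc j)) prime
           (subst (suc n ∣_) (sym ([k+1]*binomial[n+1,k+1]≡[n+1]*binomial[n,k] n j)) (m∣m*n (binomial n j)))
  ... | inj₁ p∣j+1 = contradiction p∣j+1 (p∤k (s≤s z≤n) (s≤s j<n))
  ... | inj₂ p∣C   = p∣C

  binomial≡sgn : ∀ {j} → j ≤ n → Divisible (binomialℚ n j - sgn j)
  binomial≡sgn {zero}  _   = divisible-ι (divides 0 refl)
  binomial≡sgn {suc j} j<n = subst Divisible pascal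
    (divisible-- (binomialℚ (suc n) (suc j)) (binomialℚ n j - sgn j) (divisible-ι (p∣binomial[p,j+1] j<n)) (binomial≡sgn (ℕP.<⇒≤ j<n)))
    where
    pascal : binomialℚ (suc n) (suc j) - (binomialℚ n j - sgn j) ≡ binomialℚ n (suc j) - sgn (suc j)
    pascal = begin
      ι (binomial n j ℕ.+ binomial n (suc j)) - (binomialℚ n j - sgn j)
        ≡⟨ cong (_- (binomialℚ n j - sgn j)) (ι-+ (binomial n j) (binomial n (suc j))) ⟩
      binomialℚ n j + binomialℚ n (suc j) - (binomialℚ n j - sgn j)
        ≡⟨ solve 3 (λ a b s → a :+ b :+ :- (a :+ :- s) := b :+ :- (:- s)) refl (binomialℚ n j) (binomialℚ n (suc j)) (sgn j) ⟩
      binomialℚ n (suc j) - - sgn j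
        ≡⟨ cong (λ s → binomialℚ n (suc j) - s) (sgn-suc j) ⟨
      binomialℚ n (suc j) - sgn (suc j) ∎

  integral-invBinomial : ∀ {j} → j ≤ n → Integral (invBinomial n j)
  integral-invBinomial {j} j≤n = integral-inv-p∤ {binomial n j} λ p∣C → ¬divisible-sgn j (subst Divisible (solve 2 (λ c s → c :+ :- (c :+ :- s) := s) refl (binomialℚ n j) (sgn j))
    (divisible-- (binomialℚ n j) (binomialℚ n j - sgn j) (divisible-ι p∣C) (binomial≡sgn j≤n)))

  invBinomial≡sgn : ∀ {j} → j ≤ n → Divisible (invBinomial n j - sgn j)
  invBinomial≡sgn {j} j≤n = subst Divisible factor
    (integral*divisible (- (sgn j * invBinomial n j)) (binomialℚ n j - sgn j)
      (integral-neg (sgn j * invBinomial n j) (integral-* (sgn j) (invBinomial n j) (integral-sgn j) (integral-invBinomial j≤n)))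
      (binomial≡sgn j≤n))
    where
    factor : - (sgn j * invBinomial n j) * (binomialℚ n j - sgn j) ≡ invBinomial n j - sgn j
    factor = begin
      - (sgn j * invBinomial n j) * (binomialℚ n j - sgn j)
        ≡⟨ solve 3 (λ s i c → :- (s :* i) :* (c :+ :- s) := :- (s :* (c :* i)) :+ s :* s :* i) refl (sgn j) (invBinomial n j) (binomialℚ n j) ⟩
      - (sgn j * (binomialℚ n j * invBinomial n j)) + sgn j * sgn j * invBinomial n j
        ≡⟨ cong₂ (λ u v → - (sgn j * u) + v * invBinomial n j) (ι*inv≡1 (binomial n j) (k≤n⇒binomial≢0 j≤n)) (sgn*sgn≡1 j) ⟩
      - (sgn j * 1ℚ) + 1ℚ * invBinomial n j
        ≡⟨ solve 2 (λ s i → :- (s :* con 1ℚ) :+ con 1ℚ :* i := i :+ :- s) refl (sgn j) (invBinomial n j) ⟩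
      invBinomial n j - sgn j ∎

  integral-inv[k^2] : ∀ {k} → k ≤ n → Integral (inv (k ^ 2))
  integral-inv[k^2] {k} k≤n = subst Integral (sym (inv[k^2]≡inv[k]*inv[k] k))
    (integral-* (inv k) (inv k) (integral-inv (s≤s k≤n)) (integral-inv (s≤s k≤n)))

  ∑-alt-binomial-weighted≡-∑ : ∀ c → (∀ k → k ≤ n → Integral (c k)) →
    Divisible (∑ (suc n) (λ k → - (sgn k * c k) * binomialℚ n k) + ∑ (suc n) c)
  ∑-alt-binomial-weighted≡-∑ c ic = subst Divisible (∑-distrib-+ (suc n) _ c) (divisible-∑ (suc n) _ λ k k<1+n →
    subst Divisible (sym (twist k))
      (integral*divisible (- (sgn k * c k)) (binomialℚ n k - sgn k)
        (integral-neg (sgn k * c k) (integral-* (sgn k) (c k) (integral-sgn k) (ic k (ℕP.≤-pred k<1+n))))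
        (binomial≡sgn (ℕP.≤-pred k<1+n))))
    where
    twist : ∀ k → - (sgn k * c k) * binomialℚ n k + c k ≡ - (sgn k * c k) * (binomialℚ n k - sgn k)
    twist k = begin
      - (sgn k * c k) * binomialℚ n k + c k
        ≡⟨ cong (- (sgn k * c k) * binomialℚ n k +_) (trans (cong (_* c k) (sgn*sgn≡1 k)) (ℚP.*-identityˡ (c k))) ⟨
      - (sgn k * c k) * binomialℚ n k + sgn k * sgn k * c k
        ≡⟨ solve 3 (λ s x b → :- (s :* x) :* b :+ s :* s :* x := :- (s :* x) :* (b :+ :- s)) refl (sgn k) (c k) (binomialℚ n k) ⟩
      - (sgn k * c k) * (binomialℚ n k - sgn k) ∎

  harmonic≡0 : Divisible (harmonic n)
  harmonic≡0 = divisible-cancel-ι (harmonic n) (s≤s z≤n) 2<p (subst Divisible H+H≡2H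
    (∑-alt-binomial-weighted≡-∑ inv λ k k≤n → integral-inv (s≤s k≤n)))
    where
    H+H≡2H : ∑ (suc n) (λ k → - (sgn k * inv k) * binomialℚ n k) + harmonic n ≡ ι 2 * harmonic n
    H+H≡2H = trans (cong (_+ harmonic n) (∑-alt-binomial/k≡harmonic n))
                   (solve 1 (λ h → h :+ h := con (ι 2) :* h) refl (harmonic n))

  nestedHarmonic+harmonic₂≡0 : Divisible (nestedHarmonic n + harmonic₂ n)
  nestedHarmonic+harmonic₂≡0 = subst Divisible (cong (_+ harmonic₂ n) (∑-alt-binomial/k²≡nestedHarmonic n))
    (∑-alt-binomial-weighted≡-∑ (λ k → inv (k ^ 2)) λ k k≤n → integral-inv[k^2] k≤n)

  harmonic₂≡0 : 3 < suc n → Divisible (harmonic₂ n)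
  harmonic₂≡0 3<p = divisible-cancel-ι (harmonic₂ n) (s≤s z≤n) 3<p (subst Divisible 2[HH+H₂]-H²≡3H₂
    (divisible-- (ι 2 * (nestedHarmonic n + harmonic₂ n)) (harmonic n * harmonic n)
      (integral*divisible (ι 2) (nestedHarmonic n + harmonic₂ n) (integral-ι 2) nestedHarmonic+harmonic₂≡0)
      (divisible*integral (harmonic n) (harmonic n) harmonic≡0 (proj₂ harmonic≡0))))
    where
    2[HH+H₂]-H²≡3H₂ : ι 2 * (nestedHarmonic n + harmonic₂ n) - harmonic n * harmonic n ≡ ι 3 * harmonic₂ n
    2[HH+H₂]-H²≡3H₂ = begin
      ι 2 * (nestedHarmonic n + harmonic₂ n) - harmonic n * harmonic n
        ≡⟨ solve 3 (λ a b c → con (ι 2) :* (a :+ b) :+ :- c := con (ι 2) :* a :+ :- c :+ con (ι 2) :* b)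
             refl (nestedHarmonic n) (harmonic₂ n) (harmonic n * harmonic n) ⟩
      ι 2 * nestedHarmonic n - harmonic n * harmonic n + ι 2 * harmonic₂ n
        ≡⟨ cong (λ x → x - harmonic n * harmonic n + ι 2 * harmonic₂ n) (2*nestedHarmonic≡harmonic²+harmonic₂ n) ⟩
      harmonic n * harmonic n + harmonic₂ n - harmonic n * harmonic n + ι 2 * harmonic₂ n
        ≡⟨ solve 2 (λ a b → a :+ b :+ :- a :+ con (ι 2) :* b := con (ι 3) :* b) refl (harmonic n * harmonic n) (harmonic₂ n) ⟩
      ι 3 * harmonic₂ n ∎

  altHarmonic₂≡0 : Divisible (altHarmonic₂ n)
  altHarmonic₂≡0 = divisible-cancel-ι (altHarmonic₂ n) (s≤s z≤n) 2<p (subst Divisible ∑≡2A₂ (divisible-∑ (suc n) _ λ k k<1+n →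
    integral*divisible (sgn k * inv (k ^ 2)) (invBinomial n k - sgn k)
      (integral-* (sgn k) (inv (k ^ 2)) (integral-sgn k) (integral-inv[k^2] (ℕP.≤-pred k<1+n)))
      (invBinomial≡sgn (ℕP.≤-pred k<1+n))))
    where
    split : ∀ k → sgn k * inv (k ^ 2) * (invBinomial n k - sgn k) ≡ sgn k * inv (k ^ 2) * invBinomial n k - inv (k ^ 2)
    split k = begin
      sgn k * inv (k ^ 2) * (invBinomial n k - sgn k)
        ≡⟨ solve 3 (λ s q b → s :* q :* (b :+ :- s) := s :* q :* b :+ :- (s :* s :* q)) refl (sgn k) (inv (k ^ 2)) (invBinomial n k) ⟩
      sgn k * inv (k ^ 2) * invBinomial n k - sgn k * sgn k * inv (k ^ 2)
        ≡⟨ cong (λ x → sgn k * inv (k ^ 2) * invBinomial n k - x * inv (k ^ 2)) (sgn*sgn≡1 k) ⟩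
      sgn k * inv (k ^ 2) * invBinomial n k - 1ℚ * inv (k ^ 2)
        ≡⟨ cong (λ x → sgn k * inv (k ^ 2) * invBinomial n k - x) (ℚP.*-identityˡ (inv (k ^ 2))) ⟩
      sgn k * inv (k ^ 2) * invBinomial n k - inv (k ^ 2) ∎
    ∑≡2A₂ : ∑ (suc n) (λ k → sgn k * inv (k ^ 2) * (invBinomial n k - sgn k)) ≡ ι 2 * altHarmonic₂ n
    ∑≡2A₂ = begin
      ∑ (suc n) (λ k → sgn k * inv (k ^ 2) * (invBinomial n k - sgn k))
        ≡⟨ trans (∑-cong (suc n) λ k _ → split k) (∑-distrib-- (suc n) _ _) ⟩
      altInvBinomialSum₂ n - harmonic₂ n
        ≡⟨ cong (_- harmonic₂ n) (altInvBinomialSum₂≡harmonic₂+2*altHarmonic₂ n) ⟩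
      harmonic₂ n + ι 2 * altHarmonic₂ n - harmonic₂ n
        ≡⟨ solve 2 (λ h a → h :+ a :+ :- h := a) refl (harmonic₂ n) (ι 2 * altHarmonic₂ n) ⟩
      ι 2 * altHarmonic₂ n ∎

  -- For p = 3 it is the factor 3 itself that is divisible by p.
  3*[harmonic₂+altHarmonic₂]≡0 : Divisible (ι 3 * (harmonic₂ n + altHarmonic₂ n))
  3*[harmonic₂+altHarmonic₂]≡0 with ℕP.m≤n⇒m<n∨m≡n 2<p
  ... | inj₁ 3<p = integral*divisible (ι 3) (harmonic₂ n + altHarmonic₂ n) (integral-ι 3) (divisible-+ (harmonic₂ n) (altHarmonic₂ n) (harmonic₂≡0 3<p) altHarmonic₂≡0)
  ... | inj₂ 3≡p = divisible*integral (ι 3) (harmonic₂ n + altHarmonic₂ n) (divisible-ι (subst (_∣ 3) 3≡p ∣-refl))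
                     (integral-+ (harmonic₂ n) (altHarmonic₂ n) integral-harmonic₂ (proj₂ altHarmonic₂≡0))
    where
    integral-harmonic₂ : Integral (harmonic₂ n)
    integral-harmonic₂ = integral-∑ (suc n) _ λ k k<1+n → integral-inv[k^2] (ℕP.≤-pred k<1+n)

  altHarmonic+2*fermatQuotient2≡0 : Divisible (altHarmonic n + ι 2 * fermatQuotient2 (suc n))
  altHarmonic+2*fermatQuotient2≡0 = subst Divisible (sym regroup) (divisible-∑ n _ λ j j<n →
    divisible*integral (binomialℚ n j - sgn j) (inv (suc j)) (binomial≡sgn (ℕP.<⇒≤ j<n)) (integral-inv (s≤s j<n)))
    where
    regroup : altHarmonic n + ι 2 * fermatQuotient2 (suc n) ≡ ∑ n (λ j → (binomialℚ n j - sgn j) * inv (suc j))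
    regroup = begin
      altHarmonic n + ι 2 * fermatQuotient2 (suc n)
        ≡⟨ cong₂ _+_ (trans (∑-suc n (λ k → sgn k * inv k)) (ℚP.+-identityˡ (∑ n (λ j → sgn (suc j) * inv (suc j)))))
                     (2*fermatQuotient2≡∑binomial/[j+1] n) ⟩
      ∑ n (λ j → sgn (suc j) * inv (suc j)) + ∑ n (λ j → binomialℚ n j * inv (suc j))
        ≡⟨ ∑-distrib-+ n _ _ ⟨
      ∑ n (λ j → sgn (suc j) * inv (suc j) + binomialℚ n j * inv (suc j))
        ≡⟨ ∑-cong n (λ j _ → cong (λ s → s * inv (suc j) + binomialℚ n j * inv (suc j)) (sgn-suc j)) ⟩
      ∑ n (λ j → - sgn j * inv (suc j) + binomialℚ n j * inv (suc j))
        ≡⟨ ∑-cong n (λ j _ → solve 3 (λ s i b → :- s :* i :+ b :* i := (b :+ :- s) :* i) refl (sgn j) (inv (suc j)) (binomialℚ n j)) ⟩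
      ∑ n (λ j → (binomialℚ n j - sgn j) * inv (suc j)) ∎

-- Opened only here: with ℤ's +_ in scope, sections such as (x +_) above would be ambiguous.
open import Data.Integer using (+_)

mainTheorem3 : (p : ℕ) → (pr : Prime p) → p > 2 →
    S p ≡ - ((+ 2 / 1) * fermatQuotient2 p {{prime⇒nonZero pr}}) [modℚ p ]
mainTheorem3 (suc (suc zero)) _ (s≤s (s≤s ()))
mainTheorem3 (suc n@(suc (suc t))) pr 2<p =
  divisible⇒≡[modℚ] {S (suc n)} { - (ι 2 * q)} (subst Divisible (sym S+2q≡[Y/2]+Z)
    (divisible-+ (inv 2 * Y) Z (integral*divisible (inv 2) Y (integral-inv 2<p) 3*[harmonic₂+altHarmonic₂]≡0)
                               altHarmonic+2*fermatQuotient2≡0))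
  where
  open PIntegral pr
  open Congruences pr 2<p
  q Y Z : ℚ
  q = fermatQuotient2 (suc n)
  Y = ι 3 * (harmonic₂ n + altHarmonic₂ n)
  Z = altHarmonic n + ι 2 * q
  sgn[p-1]≡1 : sgn n ≡ 1ℚ
  sgn[p-1]≡1 with sgn≡1⊎2∣suc n
  ... | inj₁ sgn≡1 = sgn≡1
  ... | inj₂ 2∣p   = contradiction (composite {2} 2<p 2∣p) (Prime.notComposite pr)
  S+2q≡[Y/2]+Z : S (suc n) - - (ι 2 * q) ≡ inv 2 * Y + Z
  S+2q≡[Y/2]+Z = begin
    S (suc n) - - (ι 2 * q)               ≡⟨ cong (_- - (ι 2 * q)) (S≡altSum+altHarmonic t) ⟩
    altSum n + altHarmonic n - - (ι 2 * q) ≡⟨ solve 3 (λ E A Q → E :+ A :+ :- (:- Q) := con (inv 2) :* (con (ι 2) :* E) :+ (A :+ Q))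
                                                 refl (altSum n) (altHarmonic n) (ι 2 * q) ⟩
    inv 2 * (ι 2 * altSum n) + Z          ≡⟨ cong (λ x → inv 2 * x + Z) (2*altSum≡3*[harmonic₂+altHarmonic₂] n sgn[p-1]≡1) ⟩
    inv 2 * Y + Z                         ∎
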